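{- Let $P(q,z,t)=\sum_{\pi} z^{|\pi|}q^{\#123(\pi)}t^{\#12(\pi)}$, summed over all 132-avoiding permutations $\pi$ of $\{1,\dots,n\}$, $n\ge 0$ (including the empty permutation), and let $Q(q,z,t)=\sum_{\sigma} z^{|\sigma|}q^{\#123(\sigma)}t^{\#12(\sigma)}$, summed over all permutations $\sigma$ of $\{1,\dots,n\}$, $n\ge0$, with $\#132(\sigma)=1$. Then, as formal power series, $$Q(q,z,t)=z\,P(q,zt,qt)\,Q(q,z,t)+z\,Q(q,zt,qt)\,P(q,z,t)+t^2z^2\,P(q,zt,qt)\,\bigl(P(q,z,t)-1\bigr).$$
   Context: For a permutation $\pi=\pi_1\cdots\pi_n$ of $\{1,\dots,n\}$, $|\pi|=n$; $\#12(\pi)$ is the number of pairs $i_1<i_2$ with $\pi_{i_1}<\pi_{i_2}$; $\#123(\pi)$ is the number of triples $i_1<i_2<i_3$ with $\pi_{i_1}<\pi_{i_2}<\pi_{i_3}$; $\#132(\pi)$ is the number of triples $i_1<i_2<i_3$ with $\pi_{i_1}<\pi_{i_3}<\pi_{i_2}$. A permutation is 132-avoiding if $\#132(\pi)=0$. -}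

module Defs where

open import Level using (Level)
open import Algebra.Bundles using (CommutativeRing)
open import Data.Nat as ℕ using (ℕ; zero; suc)
open import Data.Fin as Fin using (Fin; toℕ)
open import Data.Fin.Properties using (_≟_)
open import Data.Vec as Vec using (Vec; []; _∷_; lookup)
open import Data.List as List using (List; [_]; map; concatMap; filter; length; allFin; cartesianProduct; foldr)
open import Data.List.Relation.Unary.All using (All; all?)
open import Data.Product using (_×_; _,_)
open import Relation.Binary.PropositionalEquality using (_≡_)
open import Relation.Nullary.Decidable using (_×-dec_; _→-dec_)

-- Permutations
-- A permutation π = π₁⋯πₙ of {1,…,n} is represented (order-isomorphically,
-- shifting values down by one) as a word of length n over Fin n = {0,…,n-1}
-- which is injective.

words : (n k : ℕ) → List (Vec (Fin n) k)
words n zero    = [ [] ]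
words n (suc k) = concatMap (λ i → map (i ∷_) (words n k)) (allFin n)

pairs : (n : ℕ) → List (Fin n × Fin n)
pairs n = cartesianProduct (allFin n) (allFin n)

triples : (n : ℕ) → List (Fin n × Fin n × Fin n)
triples n = cartesianProduct (allFin n) (pairs n)

IsPerm : {n : ℕ} → Vec (Fin n) n → Set
IsPerm {n} π = All (λ { (i , j) → lookup π i ≡ lookup π j → i ≡ j }) (pairs n)

perms : (n : ℕ) → List (Vec (Fin n) n)
perms n = filter (λ π → all? (λ { (i , j) → (lookup π i ≟ lookup π j) →-dec (i ≟ j) }) (pairs n)) (words n n)

#12 : {n : ℕ} → Vec (Fin n) n → ℕ
#12 {n} π = length (filter (λ { (i , j) → (i Fin.<? j) ×-dec (lookup π i Fin.<? lookup π j) }) (pairs n))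

#123 : {n : ℕ} → Vec (Fin n) n → ℕ
#123 {n} π = length (filter (λ { (i , j , k) →
    (i Fin.<? j) ×-dec (j Fin.<? k) ×-dec
    (lookup π i Fin.<? lookup π j) ×-dec (lookup π j Fin.<? lookup π k) }) (triples n))

#132 : {n : ℕ} → Vec (Fin n) n → ℕ
#132 {n} π = length (filter (λ { (i , j , k) →
    (i Fin.<? j) ×-dec (j Fin.<? k) ×-dec
    (lookup π i Fin.<? lookup π k) ×-dec (lookup π k Fin.<? lookup π j) }) (triples n))

av132 : (n : ℕ) → List (Vec (Fin n) n)
av132 n = filter (λ π → #132 π ℕ.≟ 0) (perms n)

one132 : (n : ℕ) → List (Vec (Fin n) n)
one132 n = filter (λ π → #132 π ℕ.≟ 1) (perms n)

-- The coefficients of P and Q are polynomials in q and t (finite sums),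
-- so an identity in ℤ[q,t][[z]] is the same as the identity of coefficients
-- holding in every commutative ring R for all values q t ∈ R.

module Series {c ℓ : Level} (R : CommutativeRing c ℓ) where
  open CommutativeRing R

  Ser : Set c
  Ser = ℕ → Carrier

  sumR : List Carrier → Carrier
  sumR = foldr _+_ 0#

  infixr 8 _^_
  _^_ : Carrier → ℕ → Carrier
  x ^ zero  = 1#
  x ^ suc n = x * (x ^ n)

  -- coefficient of z^n of  Σ_π (c z)^{|π|} q^{#123 π} t^{#12 π}
  -- summed over the list L n of permutations of length n
  gf : ((n : ℕ) → List (Vec (Fin n) n)) → Carrier → Carrier → Carrier → Ser
  gf L q c t n = (c ^ n) * sumR (map (λ π → (q ^ #123 π) * (t ^ #12 π)) (L n))

  -- P(q, c·z, t) and Q(q, c·z, t)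
  P Q : Carrier → Carrier → Carrier → Ser
  P = gf av132
  Q = gf one132

  one : Ser
  one zero    = 1#
  one (suc n) = 0#

  _⊕_ _⊖_ _⊛_ : Ser → Ser → Ser
  (f ⊕ g) n = f n + g n
  (f ⊖ g) n = f n - g n
  (f ⊛ g) n = sumR (map (λ k → f (toℕ k) * g (n ℕ.∸ toℕ k)) (allFin (suc n)))

  zMul : Ser → Ser
  zMul f zero    = 0#
  zMul f (suc n) = f n

  _·_ : Carrier → Ser → Ser
  (a · f) n = a * f n

  infixl 6 _⊕_ _⊖_
  infixl 7 _⊛_
  infixr 8 _·_

{-# OPTIONS --safe #-}
-- Write a permutation σ of {0,…,n} with exactly one 132 as σ = α n β around its maximum n.
-- The maximum adds |α| to #12 and #12(α) to #123, and it creates one 132 for every pair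
-- a ∈ α, b ∈ β with a < b.  Without such a pair every entry of α exceeds every entry of β,
-- so α and β are shifted permutations, one avoiding 132 and the other containing it once:
-- this gives z P(q,zt,qt) Q + z Q(q,zt,qt) P.  Otherwise (a, n, b) is the only 132, which
-- forces b = |β| and a = |β| - 1 to be the last entry of α, with the rest of α above b and
-- the rest of β below a; deleting a and renaming b to a leaves two 132-avoiding
-- permutations, the second nonempty, which gives t² z² P(q,zt,qt) (P - 1).  The identity
-- is proved coefficientwise, summing over the position of the maximum.
module Submission where

open import Defs
open import Level using (Level)
open import Algebra.Bundles using (CommutativeRing)
open import Data.Nat using (ℕ)
open import Data.Nat using (zero; suc; _∸_)


module ListSums where
  open import Data.Bool using (Bool; true; false; _∧_)
  open import Data.Bool.Properties using (∧-zeroʳ)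
  open import Data.Empty using (⊥-elim)
  open import Data.Fin as Fin using (Fin)
  open import Data.List using (List; []; _∷_; _++_; map; length; filter; cartesianProduct; allFin)
  import Data.List.Properties as List
  open import Data.List.Membership.Propositional using (_∈_)
  open import Data.List.Relation.Binary.Sublist.Propositional using ([]; _∷_; _∷ʳ_) renaming (_⊆_ to _⊑_)
  open import Data.List.Relation.Unary.All as All using (All)
  open import Data.List.Relation.Unary.AllPairs using ([]; _∷_)
  open import Data.List.Relation.Unary.Any using (here; there)
  open import Data.List.Relation.Unary.Unique.Propositional using (Unique)
  open import Data.Nat using (zero; suc; _+_; _≤_; _≟_; z≤n)
  open import Data.Nat.ListAction using (sum)
  open import Data.Nat.ListAction.Properties using (sum-++)
  open import Data.Nat.Properties
  open import Data.Nat.Tactic.RingSolver using (solve-∀)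
  open import Data.Product using (_×_; _,_; ∃-syntax)
  open import Data.Vec as Vec using (Vec; lookup; toList)
  open import Function using (_∘_)
  open import Relation.Binary.PropositionalEquality
  open import Relation.Nullary using (Dec; does; yes; no)
  open Vec.Vec

  private
    variable
      A B : Set

  𝟙 : Bool → ℕ
  𝟙 true  = 1
  𝟙 false = 0

  ∑ : List A → (A → ℕ) → ℕ
  ∑ xs f = sum (map f xs)

  ∑-pairs : (A → A → ℕ) → List A → ℕ
  ∑-pairs f []       = 0
  ∑-pairs f (x ∷ xs) = ∑ xs (f x) + ∑-pairs f xs

  ∑-triples : (A → A → A → ℕ) → List A → ℕ
  ∑-triples g []       = 0
  ∑-triples g (x ∷ xs) = ∑-pairs (g x) xs + ∑-triples g xs

  ∑-++ : ∀ (xs ys : List A) (f : A → ℕ) → ∑ (xs ++ ys) f ≡ ∑ xs f + ∑ ys f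
  ∑-++ xs ys f = trans (cong sum (List.map-++ f xs ys)) (sum-++ (map f xs) (map f ys))

  ∑-cong : ∀ (xs : List A) {f g : A → ℕ} → (∀ {x} → x ∈ xs → f x ≡ g x) → ∑ xs f ≡ ∑ xs g
  ∑-cong xs f≗g = cong sum (List.map-cong-local (All.tabulate f≗g))

  ∑-0 : ∀ (xs : List A) → ∑ xs (λ _ → 0) ≡ 0
  ∑-0 []       = refl
  ∑-0 (x ∷ xs) = ∑-0 xs

  ∑≡0 : ∀ (xs : List A) {f} → (∀ {x} → x ∈ xs → f x ≡ 0) → ∑ xs f ≡ 0
  ∑≡0 xs f≡0 = trans (∑-cong xs f≡0) (∑-0 xs)

  ∑-map : ∀ (g : B → A) xs (f : A → ℕ) → ∑ (map g xs) f ≡ ∑ xs (f ∘ g)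
  ∑-map g xs f = cong sum (sym (List.map-∘ xs))

  ∑-insert : ∀ (xs : List A) y ys f → ∑ (xs ++ y ∷ ys) f ≡ f y + ∑ (xs ++ ys) f
  ∑-insert []       y ys f = refl
  ∑-insert (x ∷ xs) y ys f rewrite ∑-insert xs y ys f = +-comm-middle (f x) (f y) (∑ (xs ++ ys) f)
    where
    +-comm-middle : ∀ a b c → a + (b + c) ≡ b + (a + c)
    +-comm-middle = solve-∀

  term≤∑ : ∀ {xs : List A} {x} f → x ∈ xs → f x ≤ ∑ xs f
  term≤∑ {xs = y ∷ xs} f (here refl) = m≤m+n (f y) _
  term≤∑ {xs = y ∷ xs} f (there x∈)  = ≤-trans (term≤∑ f x∈) (m≤n+m _ (f y))

  ∑-mono : ∀ (xs : List A) {f g} → (∀ x → f x ≤ g x) → ∑ xs f ≤ ∑ xs g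
  ∑-mono []       f≤g = z≤n
  ∑-mono (x ∷ xs) f≤g = +-mono-≤ (f≤g x) (∑-mono xs f≤g)

  2≤∑ : ∀ {xs : List A} {a b} f → Unique xs → a ∈ xs → b ∈ xs → a ≢ b → 1 ≤ f a → 1 ≤ f b → 2 ≤ ∑ xs f
  2≤∑ f _        (here refl) (here refl) a≢b _   _   = ⊥-elim (a≢b refl)
  2≤∑ f _        (here refl) (there b∈)  _   1≤a 1≤b = +-mono-≤ 1≤a (≤-trans 1≤b (term≤∑ f b∈))
  2≤∑ f _        (there a∈)  (here refl) _   1≤a 1≤b =
    subst (2 ≤_) (+-comm _ (f _)) (+-mono-≤ (≤-trans 1≤a (term≤∑ f a∈)) 1≤b)
  2≤∑ f (_ ∷ xs!) (there a∈) (there b∈)  a≢b 1≤a 1≤b = ≤-trans (2≤∑ f xs! a∈ b∈ a≢b 1≤a 1≤b) (m≤n+m _ _)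

  ∑-single : ∀ {xs : List A} {v} f → Unique xs → v ∈ xs → (∀ {x} → x ∈ xs → x ≢ v → f x ≡ 0) → f v ≡ 1 → ∑ xs f ≡ 1
  ∑-single {xs = _ ∷ xs} f (v∉ ∷ _)   (here refl) others fv≡1 =
    cong₂ _+_ fv≡1 (∑≡0 xs (λ x∈ → others (there x∈) (λ x≡v → All.lookup v∉ x∈ (sym x≡v))))
  ∑-single {xs = _ ∷ xs} f (x∉ ∷ xs!) (there v∈)  others fv≡1 =
    cong₂ _+_ (others (here refl) (λ x≡v → All.lookup x∉ v∈ x≡v)) (∑-single f xs! v∈ (others ∘ there) fv≡1)

  ∑≡0⇒ : ∀ {xs : List A} {x} f → ∑ xs f ≡ 0 → x ∈ xs → f x ≡ 0
  ∑≡0⇒ f ∑≡0 x∈ = n≤0⇒n≡0 (subst (_ ≤_) ∑≡0 (term≤∑ f x∈))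

  ∑≢0⇒ : ∀ (xs : List A) f → ∑ xs f ≢ 0 → ∃[ x ] x ∈ xs × f x ≢ 0
  ∑≢0⇒ []       f ∑≢0 = ⊥-elim (∑≢0 refl)
  ∑≢0⇒ (x ∷ xs) f ∑≢0 with f x ≟ 0
  ... | no  fx≢0 = x , here refl , fx≢0
  ... | yes fx≡0 with y , y∈ , fy≢0 ← ∑≢0⇒ xs f (λ ∑≡0 → ∑≢0 (trans (cong₂ _+_ fx≡0 ∑≡0) refl)) = y , there y∈ , fy≢0

  ∑-pairs≡0 : ∀ (xs : List A) {f} → (∀ {x y} → x ∈ xs → y ∈ xs → f x y ≡ 0) → ∑-pairs f xs ≡ 0
  ∑-pairs≡0 []       f≡0 = refl
  ∑-pairs≡0 (x ∷ xs) f≡0 =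
    cong₂ _+_ (∑≡0 xs (f≡0 (here refl) ∘ there)) (∑-pairs≡0 xs (λ x∈ y∈ → f≡0 (there x∈) (there y∈)))

  ∑-pairs-cong-∈ : ∀ (xs : List A) {f g} → (∀ {x y} → x ∈ xs → y ∈ xs → f x y ≡ g x y) → ∑-pairs f xs ≡ ∑-pairs g xs
  ∑-pairs-cong-∈ []       f≗g = refl
  ∑-pairs-cong-∈ (x ∷ xs) f≗g =
    cong₂ _+_ (∑-cong xs (f≗g (here refl) ∘ there)) (∑-pairs-cong-∈ xs (λ x∈ y∈ → f≗g (there x∈) (there y∈)))

  ∑-triples-cong-∈ : ∀ (xs : List A) {f g} → (∀ {x y z} → x ∈ xs → y ∈ xs → z ∈ xs → f x y z ≡ g x y z) →
                     ∑-triples f xs ≡ ∑-triples g xs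
  ∑-triples-cong-∈ []       f≗g = refl
  ∑-triples-cong-∈ (x ∷ xs) f≗g = cong₂ _+_ (∑-pairs-cong-∈ xs (λ y∈ z∈ → f≗g (here refl) (there y∈) (there z∈)))
                                            (∑-triples-cong-∈ xs (λ x∈ y∈ z∈ → f≗g (there x∈) (there y∈) (there z∈)))

  ∑-pairs-++ : ∀ (f : A → A → ℕ) xs ys → ∑-pairs f (xs ++ ys) ≡ ∑-pairs f xs + ∑ xs (λ x → ∑ ys (f x)) + ∑-pairs f ys
  ∑-pairs-++ f []       ys = refl
  ∑-pairs-++ f (x ∷ xs) ys rewrite ∑-++ xs ys (f x) | ∑-pairs-++ f xs ys =
    shuffle (∑ xs (f x)) (∑ ys (f x)) (∑-pairs f xs) (∑ xs (λ x → ∑ ys (f x))) (∑-pairs f ys)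
    where
    shuffle : ∀ a b c d e → a + b + (c + d + e) ≡ a + c + (b + d) + e
    shuffle = solve-∀

  ∑-pairs-insert : ∀ (f : A → A → ℕ) xs y ys →
                   ∑-pairs f (xs ++ y ∷ ys) ≡ ∑ xs (λ x → f x y) + ∑ ys (f y) + ∑-pairs f (xs ++ ys)
  ∑-pairs-insert f []       y ys = refl
  ∑-pairs-insert f (x ∷ xs) y ys rewrite ∑-insert xs y ys (f x) | ∑-pairs-insert f xs y ys =
    shuffle (f x y) (∑ (xs ++ ys) (f x)) (∑ xs (λ x → f x y)) (∑ ys (f y)) (∑-pairs f (xs ++ ys))
    where
    shuffle : ∀ a b c d e → a + b + (c + d + e) ≡ a + c + d + (b + e)
    shuffle = solve-∀

  ∑-pairs-map : ∀ (g : B → A) (f : A → A → ℕ) xs → ∑-pairs f (map g xs) ≡ ∑-pairs (λ a b → f (g a) (g b)) xs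
  ∑-pairs-map g f []       = refl
  ∑-pairs-map g f (x ∷ xs) = cong₂ _+_ (∑-map g xs (f (g x))) (∑-pairs-map g f xs)

  ∑-triples-map : ∀ (g : B → A) (f : A → A → A → ℕ) xs →
                  ∑-triples f (map g xs) ≡ ∑-triples (λ a b c → f (g a) (g b) (g c)) xs
  ∑-triples-map g f []       = refl
  ∑-triples-map g f (x ∷ xs) = cong₂ _+_ (∑-pairs-map g (f (g x)) xs) (∑-triples-map g f xs)

  ∑-⊑ : ∀ {xs ys : List A} f → xs ⊑ ys → ∑ xs f ≤ ∑ ys f
  ∑-⊑ f []        = z≤n
  ∑-⊑ f (y ∷ʳ p)  = ≤-trans (∑-⊑ f p) (m≤n+m _ (f y))
  ∑-⊑ f (refl ∷ p) = +-monoʳ-≤ _ (∑-⊑ f p)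

  ∑-pairs-⊑ : ∀ {xs ys : List A} f → xs ⊑ ys → ∑-pairs f xs ≤ ∑-pairs f ys
  ∑-pairs-⊑ f []         = z≤n
  ∑-pairs-⊑ f (y ∷ʳ p)   = ≤-trans (∑-pairs-⊑ f p) (m≤n+m _ _)
  ∑-pairs-⊑ f (refl ∷ p) = +-mono-≤ (∑-⊑ _ p) (∑-pairs-⊑ f p)

  ∑-triples-⊑ : ∀ {xs ys : List A} g → xs ⊑ ys → ∑-triples g xs ≤ ∑-triples g ys
  ∑-triples-⊑ g []         = z≤n
  ∑-triples-⊑ g (y ∷ʳ p)   = ≤-trans (∑-triples-⊑ g p) (m≤n+m _ _)
  ∑-triples-⊑ g (refl ∷ p) = +-mono-≤ (∑-pairs-⊑ _ p) (∑-triples-⊑ g p)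

  occurrence≤∑-triples : ∀ {a b c} {xs : List A} g → (a ∷ b ∷ c ∷ []) ⊑ xs → g a b c ≤ ∑-triples g xs
  occurrence≤∑-triples g abc⊑xs = ≤-trans (≤-trans (m≤m+n _ _) (≤-trans (m≤m+n _ _) (m≤m+n _ _))) (∑-triples-⊑ g abc⊑xs)

  length-filter≡∑ : ∀ {P : A → Set} (P? : ∀ x → Dec (P x)) (xs : List A) →
                    length (filter P? xs) ≡ ∑ xs (𝟙 ∘ does ∘ P?)
  length-filter≡∑ P? []       = refl
  length-filter≡∑ P? (x ∷ xs) with does (P? x)
  ... | true  = cong suc (length-filter≡∑ P? xs)
  ... | false = length-filter≡∑ P? xs

  ∑-cartesianProduct : ∀ (xs : List A) (ys : List B) (h : A × B → ℕ) →
                       ∑ (cartesianProduct xs ys) h ≡ ∑ xs (λ x → ∑ ys (λ y → h (x , y)))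
  ∑-cartesianProduct []       ys h = refl
  ∑-cartesianProduct (x ∷ xs) ys h = begin
    ∑ (map (x ,_) ys ++ cartesianProduct xs ys) h
      ≡⟨ ∑-++ (map (x ,_) ys) _ h ⟩
    ∑ (map (x ,_) ys) h + ∑ (cartesianProduct xs ys) h
      ≡⟨ cong₂ _+_ (∑-map (x ,_) ys h) (∑-cartesianProduct xs ys h) ⟩
    ∑ ys (λ y → h (x , y)) + ∑ xs (λ x → ∑ ys (λ y → h (x , y))) ∎
    where open ≡-Reasoning

  ∑-allFin-suc : ∀ {k} (f : Fin (suc k) → ℕ) → ∑ (allFin (suc k)) f ≡ f Fin.zero + ∑ (allFin k) (f ∘ Fin.suc)
  ∑-allFin-suc {k} f = cong (f Fin.zero +_) (trans (cong (λ l → ∑ l f) (sym (List.map-tabulate (λ i → i) Fin.suc)))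
                                                    (∑-map Fin.suc (allFin k) f))

  ∑-lookup : ∀ {k} (v : Vec A k) (h : A → ℕ) → ∑ (allFin k) (h ∘ lookup v) ≡ ∑ (toList v) h
  ∑-lookup []      h = refl
  ∑-lookup (x ∷ v) h = trans (∑-allFin-suc (h ∘ lookup (x ∷ v))) (cong (h x +_) (∑-lookup v h))

  ∑-pairs-lookup : ∀ {k} (v : Vec A k) (F : A → A → Bool) →
    ∑ (allFin k) (λ i → ∑ (allFin k) (λ j → 𝟙 (does (i Fin.<? j) ∧ F (lookup v i) (lookup v j))))
    ≡ ∑-pairs (λ a b → 𝟙 (F a b)) (toList v)
  ∑-pairs-lookup []      F = refl
  ∑-pairs-lookup {k = suc k} (x ∷ v) F = trans (∑-allFin-suc (λ i → ∑ all (P i))) (cong₂ _+_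
    (trans (∑-allFin-suc (P Fin.zero)) (∑-lookup v (𝟙 ∘ F x)))
    (trans (∑-cong (allFin k) (λ {i} _ → ∑-allFin-suc (P (Fin.suc i)))) (∑-pairs-lookup v F)))
    where
    all : List (Fin (suc k))
    all = allFin (suc k)
    P : Fin (suc k) → Fin (suc k) → ℕ
    P i j = 𝟙 (does (i Fin.<? j) ∧ F (lookup (x ∷ v) i) (lookup (x ∷ v) j))

  ∑-triples-lookup : ∀ {k} (v : Vec A k) (G : A → A → A → Bool) →
    ∑ (allFin k) (λ i → ∑ (allFin k) (λ j → ∑ (allFin k) (λ l →
      𝟙 (does (i Fin.<? j) ∧ (does (j Fin.<? l) ∧ G (lookup v i) (lookup v j) (lookup v l))))))
    ≡ ∑-triples (λ a b c → 𝟙 (G a b c)) (toList v)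
  ∑-triples-lookup []      G = refl
  ∑-triples-lookup {k = suc k} (x ∷ v) G = trans (∑-allFin-suc (λ i → ∑ all (λ j → ∑ all (T i j)))) (cong₂ _+_
    (trans (∑-allFin-suc (λ j → ∑ all (T Fin.zero j)))
           (trans (cong₂ _+_ (∑-0 all) (∑-cong (allFin k) (λ {j} _ → ∑-allFin-suc (T Fin.zero (Fin.suc j)))))
                  (∑-pairs-lookup v (G x))))
    (trans (∑-cong (allFin k) (λ {i} _ → trans (∑-allFin-suc (λ j → ∑ all (T (Fin.suc i) j)))
                                               (cong₂ _+_ (∑-0 all) (∑-cong (allFin k) (λ {j} _ → drop-first i j)))))
           (∑-triples-lookup v G)))
    where
    all : List (Fin (suc k))
    all = allFin (suc k)
    T : Fin (suc k) → Fin (suc k) → Fin (suc k) → ℕ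
    T i j l = 𝟙 (does (i Fin.<? j) ∧ (does (j Fin.<? l) ∧ G (lookup (x ∷ v) i) (lookup (x ∷ v) j) (lookup (x ∷ v) l)))
    drop-first : ∀ i j → ∑ all (T (Fin.suc i) (Fin.suc j))
                       ≡ ∑ (allFin k) (λ l → 𝟙 (does (i Fin.<? j) ∧ (does (j Fin.<? l) ∧ G (lookup v i) (lookup v j) (lookup v l))))
    drop-first i j = trans (∑-allFin-suc (T (Fin.suc i) (Fin.suc j)))
                           (cong (λ b → 𝟙 b + ∑ (allFin k) (T (Fin.suc i) (Fin.suc j) ∘ Fin.suc)) (∧-zeroʳ (does (i Fin.<? j))))

module PatternCounts where
  open import Data.Bool using (_∧_)
  open import Data.Bool.Properties using (∧-zeroʳ; ∧-identityʳ)
  open import Data.Empty using (⊥-elim)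
  open import Data.Fin as Fin using (Fin; toℕ)
  open import Data.List using (List; []; _∷_; _++_; map; length; cartesianProduct; allFin)
  open import Data.List.Membership.Propositional using (_∈_)
  open import Data.List.Relation.Unary.All as All using (All; []; _∷_)
  open import Data.List.Relation.Unary.Any using (here; there)
  open import Data.Nat using (suc; _+_; _≤_; _<_; _<?_; _≤?_)
  open import Data.Nat.Properties
  open import Data.Nat.Tactic.RingSolver using (solve-∀)
  open import Data.Vec using (Vec; toList)
  open import Function using (_∘_)
  open import Relation.Binary.Definitions using (tri<; tri≈; tri>)
  open import Relation.Binary.PropositionalEquality
  open import Relation.Nullary using (does; yes; no)
  open import Relation.Nullary.Decidable using (dec-true; dec-false)

  open ListSums

  is12 : ℕ → ℕ → ℕ
  is12 x y = 𝟙 (does (x <? y))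

  is123 is132 : ℕ → ℕ → ℕ → ℕ
  is123 x y z = 𝟙 (does (x <? y) ∧ does (y <? z))
  is132 x y z = 𝟙 (does (x <? z) ∧ does (z <? y))

  #12ˡ #123ˡ #132ˡ : List ℕ → ℕ
  #12ˡ  = ∑-pairs is12
  #123ˡ = ∑-triples is123
  #132ˡ = ∑-triples is132

  is12-< : ∀ {x y} → x < y → is12 x y ≡ 1
  is12-< x<y = cong 𝟙 (dec-true (_ <? _) x<y)

  is12-≥ : ∀ {x y} → y ≤ x → is12 x y ≡ 0
  is12-≥ y≤x = cong 𝟙 (dec-false (_ <? _) (≤⇒≯ y≤x))

  1≤is12 : ∀ {x y} → x < y → 1 ≤ is12 x y
  1≤is12 x<y = ≤-reflexive (sym (is12-< x<y))

  is12≡0⇒≥ : ∀ {x y} → is12 x y ≡ 0 → y ≤ x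
  is12≡0⇒≥ {x} {y} is12≡0 with x <? y
  ... | yes x<y = ⊥-elim (1+n≢0 (trans (sym (is12-< x<y)) is12≡0))
  ... | no  x≮y = ≮⇒≥ x≮y

  is12≢0⇒< : ∀ {x y} → is12 x y ≢ 0 → x < y
  is12≢0⇒< {x} {y} is12≢0 with x <? y
  ... | yes x<y = x<y
  ... | no  x≮y = ⊥-elim (is12≢0 (is12-≥ (≮⇒≥ x≮y)))

  is123-≥ˡ : ∀ {x y z} → y ≤ x → is123 x y z ≡ 0
  is123-≥ˡ {y = y} {z} y≤x = cong (λ b → 𝟙 (b ∧ does (y <? z))) (dec-false (_ <? _) (≤⇒≯ y≤x))

  is123-≥ʳ : ∀ {x y z} → z ≤ y → is123 x y z ≡ 0
  is123-≥ʳ {x = x} {y} {z} z≤y = cong 𝟙 (trans (cong (does (x <? y) ∧_) (dec-false (y <? z) (≤⇒≯ z≤y))) (∧-zeroʳ _))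

  is123-≥ : ∀ {x y z} → z ≤ x → is123 x y z ≡ 0
  is123-≥ {x = x} {y} {z} z≤x with y ≤? x
  ... | yes y≤x = is123-≥ˡ {z = z} y≤x
  ... | no  y≰x = is123-≥ʳ (≤-trans z≤x (<⇒≤ (≰⇒> y≰x)))

  is123-below : ∀ {x y z} → y < z → is123 x y z ≡ is12 x y
  is123-below {x = x} {y} {z} y<z = cong 𝟙 (trans (cong (does (x <? y) ∧_) (dec-true (y <? z) y<z)) (∧-identityʳ _))

  is132-≥ˡ : ∀ {x y z} → z ≤ x → is132 x y z ≡ 0
  is132-≥ˡ {y = y} {z} z≤x = cong (λ b → 𝟙 (b ∧ does (z <? y))) (dec-false (_ <? _) (≤⇒≯ z≤x))

  is132-≥ʳ : ∀ {x y z} → y ≤ z → is132 x y z ≡ 0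
  is132-≥ʳ {x = x} {y} {z} y≤z = cong 𝟙 (trans (cong (does (x <? z) ∧_) (dec-false (z <? y) (≤⇒≯ y≤z))) (∧-zeroʳ _))

  is132-above : ∀ {x y z} → z < y → is132 x y z ≡ is12 x z
  is132-above {x = x} {y} {z} z<y = cong 𝟙 (trans (cong (does (x <? z) ∧_) (dec-true (z <? y) z<y)) (∧-identityʳ _))

  is132≡1 : ∀ {x y z} → x < z → z < y → is132 x y z ≡ 1
  is132≡1 {x} {y} {z} x<z z<y = cong 𝟙 (cong₂ _∧_ (dec-true (x <? z) x<z) (dec-true (z <? y) z<y))

  <?-mono : ∀ {a b c d} → (a < b → c < d) → (c < d → a < b) → does (a <? b) ≡ does (c <? d)
  <?-mono {a} {b} {c} {d} to from with a <? b
  ... | yes a<b = trans (dec-true (a <? b) a<b) (sym (dec-true (c <? d) (to a<b)))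
  ... | no  a≮b = trans (dec-false (a <? b) a≮b) (sym (dec-false (c <? d) (a≮b ∘ from)))

  word : ∀ {n k} → Vec (Fin n) k → List ℕ
  word π = map toℕ (toList π)

  module _ {n : ℕ} (π : Vec (Fin n) n) where
    open ≡-Reasoning

    #12≡#12ˡ : #12 π ≡ #12ˡ (word π)
    #12≡#12ˡ = begin
      #12 π                                          ≡⟨ length-filter≡∑ _ (cartesianProduct (allFin n) (allFin n)) ⟩
      ∑ (cartesianProduct (allFin n) (allFin n)) _   ≡⟨ ∑-cartesianProduct (allFin n) (allFin n) _ ⟩
      _                                              ≡⟨ ∑-pairs-lookup π (λ a b → does (a Fin.<? b)) ⟩
      ∑-pairs (λ a b → is12 (toℕ a) (toℕ b)) (toList π) ≡⟨ ∑-pairs-map toℕ is12 (toList π) ⟨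
      #12ˡ (word π)                                  ∎

    #123≡#123ˡ : #123 π ≡ #123ˡ (word π)
    #123≡#123ˡ = begin
      #123 π                                         ≡⟨ length-filter≡∑ _ (triples n) ⟩
      ∑ (triples n) _                                ≡⟨ ∑-cartesianProduct (allFin n) (pairs n) _ ⟩
      _                                              ≡⟨ ∑-cong (allFin n) (λ _ → ∑-cartesianProduct (allFin n) (allFin n) _) ⟩
      _                                              ≡⟨ ∑-triples-lookup π (λ a b c → does (a Fin.<? b) ∧ does (b Fin.<? c)) ⟩
      ∑-triples (λ a b c → is123 (toℕ a) (toℕ b) (toℕ c)) (toList π) ≡⟨ ∑-triples-map toℕ is123 (toList π) ⟨
      #123ˡ (word π)                                 ∎

    #132≡#132ˡ : #132 π ≡ #132ˡ (word π)
    #132≡#132ˡ = begin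
      #132 π                                         ≡⟨ length-filter≡∑ _ (triples n) ⟩
      ∑ (triples n) _                                ≡⟨ ∑-cartesianProduct (allFin n) (pairs n) _ ⟩
      _                                              ≡⟨ ∑-cong (allFin n) (λ _ → ∑-cartesianProduct (allFin n) (allFin n) _) ⟩
      _                                              ≡⟨ ∑-triples-lookup π (λ a b c → does (a Fin.<? c) ∧ does (c Fin.<? b)) ⟩
      ∑-triples (λ a b c → is132 (toℕ a) (toℕ b) (toℕ c)) (toList π) ≡⟨ ∑-triples-map toℕ is132 (toList π) ⟨
      #132ˡ (word π)                                 ∎

  _≻_ : List ℕ → List ℕ → Set
  xs ≻ ys = ∀ {x y} → x ∈ xs → y ∈ ys → y < x

  #12ˡ-across : List ℕ → List ℕ → ℕ
  #12ˡ-across xs ys = ∑ xs (λ x → ∑ ys (is12 x))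

  ∑-pairs-++-≻ : ∀ (f : ℕ → ℕ → ℕ) → (∀ {x y} → y < x → f x y ≡ 0) →
                 ∀ xs ys → xs ≻ ys → ∑-pairs f (xs ++ ys) ≡ ∑-pairs f xs + ∑-pairs f ys
  ∑-pairs-++-≻ f f-desc []       ys xs≻ys = refl
  ∑-pairs-++-≻ f f-desc (x ∷ xs) ys xs≻ys = begin
    ∑ (xs ++ ys) (f x) + ∑-pairs f (xs ++ ys)
      ≡⟨ cong₂ _+_ (∑-++ xs ys (f x)) (∑-pairs-++-≻ f f-desc xs ys (xs≻ys ∘ there)) ⟩
    ∑ xs (f x) + ∑ ys (f x) + (∑-pairs f xs + ∑-pairs f ys)
      ≡⟨ cong (λ c → ∑ xs (f x) + c + _) (∑≡0 ys (f-desc ∘ xs≻ys (here refl))) ⟩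
    ∑ xs (f x) + 0 + (∑-pairs f xs + ∑-pairs f ys)
      ≡⟨ shuffle (∑ xs (f x)) (∑-pairs f xs) (∑-pairs f ys) ⟩
    ∑ xs (f x) + ∑-pairs f xs + ∑-pairs f ys ∎
    where
    open ≡-Reasoning
    shuffle : ∀ a b c → a + 0 + (b + c) ≡ a + b + c
    shuffle = solve-∀

  ∑-triples-++-≻ : ∀ (g : ℕ → ℕ → ℕ → ℕ) → (∀ {x y z} → z < x → g x y z ≡ 0) →
                   ∀ xs ys → xs ≻ ys → ∑-triples g (xs ++ ys) ≡ ∑-triples g xs + ∑-triples g ys
  ∑-triples-++-≻ g g-desc []       ys xs≻ys = refl
  ∑-triples-++-≻ g g-desc (x ∷ xs) ys xs≻ys = begin
    ∑-pairs (g x) (xs ++ ys) + ∑-triples g (xs ++ ys)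
      ≡⟨ cong₂ _+_ (∑-pairs-++ (g x) xs ys) (∑-triples-++-≻ g g-desc xs ys (xs≻ys ∘ there)) ⟩
    ∑-pairs (g x) xs + ∑ xs (λ y → ∑ ys (g x y)) + ∑-pairs (g x) ys + (∑-triples g xs + ∑-triples g ys)
      ≡⟨ cong₂ (λ c d → ∑-pairs (g x) xs + c + d + _)
               (∑≡0 xs (λ _ → ∑≡0 ys (g-desc ∘ xs≻ys (here refl))))
               (∑-pairs≡0 ys (λ _ z∈ → g-desc (xs≻ys (here refl) z∈))) ⟩
    ∑-pairs (g x) xs + 0 + 0 + (∑-triples g xs + ∑-triples g ys)
      ≡⟨ shuffle (∑-pairs (g x) xs) (∑-triples g xs) (∑-triples g ys) ⟩
    ∑-pairs (g x) xs + ∑-triples g xs + ∑-triples g ys ∎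
    where
    open ≡-Reasoning
    shuffle : ∀ a b c → a + 0 + 0 + (b + c) ≡ a + b + c
    shuffle = solve-∀

  #12ˡ-++ : ∀ xs ys → xs ≻ ys → #12ˡ (xs ++ ys) ≡ #12ˡ xs + #12ˡ ys
  #12ˡ-++ = ∑-pairs-++-≻ is12 (is12-≥ ∘ <⇒≤)

  #123ˡ-++ : ∀ xs ys → xs ≻ ys → #123ˡ (xs ++ ys) ≡ #123ˡ xs + #123ˡ ys
  #123ˡ-++ = ∑-triples-++-≻ is123 (is123-≥ ∘ <⇒≤)

  #132ˡ-++ : ∀ xs ys → xs ≻ ys → #132ˡ (xs ++ ys) ≡ #132ˡ xs + #132ˡ ys
  #132ˡ-++ = ∑-triples-++-≻ is132 (λ {_} {y} z<x → is132-≥ˡ {y = y} (<⇒≤ z<x))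

  module _ {top : ℕ} where
    open ≡-Reasoning

    #12ˡ-insert-max : ∀ {xs ys} → All (_< top) xs → All (_< top) ys →
                      #12ˡ (xs ++ top ∷ ys) ≡ length xs + #12ˡ (xs ++ ys)
    #12ˡ-insert-max {ys = ys} []            ys<top =
      cong (_+ #12ˡ ys) (∑≡0 ys (is12-≥ ∘ <⇒≤ ∘ All.lookup ys<top))
    #12ˡ-insert-max {x ∷ xs} {ys} (x<top ∷ xs<top) ys<top = begin
      ∑ (xs ++ top ∷ ys) (is12 x) + #12ˡ (xs ++ top ∷ ys)
        ≡⟨ cong₂ _+_ (∑-insert xs top ys (is12 x)) (#12ˡ-insert-max xs<top ys<top) ⟩
      is12 x top + ∑ (xs ++ ys) (is12 x) + (length xs + #12ˡ (xs ++ ys))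
        ≡⟨ cong (λ c → c + _ + _) (is12-< x<top) ⟩
      1 + ∑ (xs ++ ys) (is12 x) + (length xs + #12ˡ (xs ++ ys))
        ≡⟨ shuffle (∑ (xs ++ ys) (is12 x)) (length xs) (#12ˡ (xs ++ ys)) ⟩
      suc (length xs) + (∑ (xs ++ ys) (is12 x) + #12ˡ (xs ++ ys)) ∎
      where
      shuffle : ∀ a b c → 1 + a + (b + c) ≡ suc b + (a + c)
      shuffle = solve-∀

    #123ˡ-insert-max : ∀ {xs ys} → All (_< top) xs → All (_< top) ys →
                       #123ˡ (xs ++ top ∷ ys) ≡ #12ˡ xs + #123ˡ (xs ++ ys)
    #123ˡ-insert-max {ys = ys} []            ys<top =
      cong (_+ #123ˡ ys) (∑-pairs≡0 ys (λ {_} {z} y∈ _ → is123-≥ˡ {z = z} (<⇒≤ (All.lookup ys<top y∈))))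
    #123ˡ-insert-max {x ∷ xs} {ys} (x<top ∷ xs<top) ys<top = begin
      ∑-pairs (is123 x) (xs ++ top ∷ ys) + #123ˡ (xs ++ top ∷ ys)
        ≡⟨ cong₂ _+_ (∑-pairs-insert (is123 x) xs top ys) (#123ˡ-insert-max xs<top ys<top) ⟩
      ∑ xs (λ y → is123 x y top) + ∑ ys (is123 x top) + ∑-pairs (is123 x) (xs ++ ys) + (#12ˡ xs + #123ˡ (xs ++ ys))
        ≡⟨ cong₂ (λ a b → a + b + _ + _) (∑-cong xs (is123-below ∘ All.lookup xs<top))
                                         (∑≡0 ys (λ y∈ → is123-≥ʳ (<⇒≤ (All.lookup ys<top y∈)))) ⟩
      ∑ xs (is12 x) + 0 + ∑-pairs (is123 x) (xs ++ ys) + (#12ˡ xs + #123ˡ (xs ++ ys))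
        ≡⟨ shuffle (∑ xs (is12 x)) (∑-pairs (is123 x) (xs ++ ys)) (#12ˡ xs) (#123ˡ (xs ++ ys)) ⟩
      ∑ xs (is12 x) + #12ˡ xs + (∑-pairs (is123 x) (xs ++ ys) + #123ˡ (xs ++ ys)) ∎
      where
      shuffle : ∀ a b c d → a + 0 + b + (c + d) ≡ a + c + (b + d)
      shuffle = solve-∀

    #132ˡ-insert-max : ∀ {xs ys} → All (_< top) xs → All (_< top) ys →
                       #132ˡ (xs ++ top ∷ ys) ≡ #12ˡ-across xs ys + #132ˡ (xs ++ ys)
    #132ˡ-insert-max {ys = ys} []            ys<top =
      cong (_+ #132ˡ ys) (∑-pairs≡0 ys (λ {y} _ z∈ → is132-≥ˡ {y = y} (<⇒≤ (All.lookup ys<top z∈))))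
    #132ˡ-insert-max {x ∷ xs} {ys} (x<top ∷ xs<top) ys<top = begin
      ∑-pairs (is132 x) (xs ++ top ∷ ys) + #132ˡ (xs ++ top ∷ ys)
        ≡⟨ cong₂ _+_ (∑-pairs-insert (is132 x) xs top ys) (#132ˡ-insert-max xs<top ys<top) ⟩
      ∑ xs (λ y → is132 x y top) + ∑ ys (is132 x top) + ∑-pairs (is132 x) (xs ++ ys) + (#12ˡ-across xs ys + #132ˡ (xs ++ ys))
        ≡⟨ cong₂ (λ a b → a + b + _ + _) (∑≡0 xs (λ y∈ → is132-≥ʳ (<⇒≤ (All.lookup xs<top y∈))))
                                         (∑-cong ys (is132-above ∘ All.lookup ys<top)) ⟩
      0 + ∑ ys (is12 x) + ∑-pairs (is132 x) (xs ++ ys) + (#12ˡ-across xs ys + #132ˡ (xs ++ ys))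
        ≡⟨ shuffle (∑ ys (is12 x)) (∑-pairs (is132 x) (xs ++ ys)) (#12ˡ-across xs ys) (#132ˡ (xs ++ ys)) ⟩
      ∑ ys (is12 x) + #12ˡ-across xs ys + (∑-pairs (is132 x) (xs ++ ys) + #132ˡ (xs ++ ys)) ∎
      where
      shuffle : ∀ a b c d → 0 + a + b + (c + d) ≡ a + c + (b + d)
      shuffle = solve-∀

  module Relabel (h : ℕ → ℕ) (xs : List ℕ) (h-mono : ∀ {a b} → a ∈ xs → b ∈ xs → a < b → h a < h b) where

    private
      h-reflects : ∀ {a b} → a ∈ xs → b ∈ xs → h a < h b → a < b
      h-reflects {a} {b} a∈ b∈ ha<hb with <-cmp a b
      ... | tri< a<b _ _ = a<b
      ... | tri≈ _ refl _ = ⊥-elim (<-irrefl refl ha<hb)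
      ... | tri> _ _ b<a = ⊥-elim (<-asym ha<hb (h-mono b∈ a∈ b<a))

      <?-h : ∀ {a b} → a ∈ xs → b ∈ xs → does (h a <? h b) ≡ does (a <? b)
      <?-h a∈ b∈ = <?-mono (h-reflects a∈ b∈) (h-mono a∈ b∈)

    #12ˡ-map : #12ˡ (map h xs) ≡ #12ˡ xs
    #12ˡ-map = trans (∑-pairs-map h is12 xs) (∑-pairs-cong-∈ xs (λ a∈ b∈ → cong 𝟙 (<?-h a∈ b∈)))

    #123ˡ-map : #123ˡ (map h xs) ≡ #123ˡ xs
    #123ˡ-map = trans (∑-triples-map h is123 xs)
      (∑-triples-cong-∈ xs (λ a∈ b∈ c∈ → cong 𝟙 (cong₂ _∧_ (<?-h a∈ b∈) (<?-h b∈ c∈))))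

    #132ˡ-map : #132ˡ (map h xs) ≡ #132ˡ xs
    #132ˡ-map = trans (∑-triples-map h is132 xs)
      (∑-triples-cong-∈ xs (λ a∈ b∈ c∈ → cong 𝟙 (cong₂ _∧_ (<?-h a∈ c∈) (<?-h c∈ b∈))))

module PermutationLists where
  open import Data.Empty using (⊥-elim)
  open import Data.Fin as Fin using (Fin; toℕ; fromℕ<)
  open import Data.Fin.Properties as Fin using (toℕ-injective; toℕ-fromℕ<; toℕ<n)
  open import Data.List using (List; []; _∷_; _++_; map; length; filter; cartesianProduct; allFin; concatMap; take; drop)
  import Data.List.Properties as List
  open import Data.List.Membership.Propositional using (_∈_; _∉_)
  open import Data.List.Membership.Propositional.Properties
    using (∈-filter⁺; ∈-filter⁻; ∈-map⁺; ∈-map⁻; ∈-upTo⁺; ∈-cartesianProduct⁺; ∈-allFin; ∈-++⁺ˡ; ∈-++⁺ʳ; ∈-++⁻)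
  open import Data.List.Membership.Propositional.Properties.WithK using (unique∧set⇒bag)
  open import Data.List.Relation.Binary.BagAndSetEquality using (∼bag⇒↭)
  open import Data.List.Relation.Binary.Disjoint.Propositional using (Disjoint)
  open import Data.List.Relation.Binary.Permutation.Propositional.Properties using (↭-length)
  open import Data.List.Relation.Binary.Subset.Propositional using (_⊆_)
  open import Data.List.Relation.Unary.All as All using (All; []; _∷_)
  import Data.List.Relation.Unary.All.Properties as All
  open import Data.List.Relation.Unary.AllPairs using ([]; _∷_)
  open import Data.List.Relation.Unary.Any using (here; there)
  open import Data.List.Relation.Unary.Unique.Propositional using (Unique)
  import Data.List.Relation.Unary.Unique.Propositional.Properties as Unique
  open import Data.Nat using (zero; suc; _+_; _∸_; _≤_; _<_; _≟_; s≤s; z≤n)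
  open import Data.Nat.Properties
  open import Data.List.Membership.DecPropositional _≟_ using (_∈?_)
  open import Data.Product using (_×_; _,_; proj₁; proj₂)
  open import Data.Sum using (_⊎_; inj₁; inj₂)
  open import Data.Vec as Vec using (Vec; lookup; toList)
  import Data.Vec.Properties as Vec
  import Data.Vec.Relation.Unary.Any as Any
  open import Data.Vec.Relation.Unary.Any.Properties using (lookup-index)
  open import Data.Vec.Membership.Propositional.Properties using (∈-lookup; ∈-toList⁺; ∈-toList⁻)
  open import Function using (_∘_; _$_; mk⇔)
  open import Relation.Binary.PropositionalEquality
  open import Relation.Nullary using (yes; no)

  open ListSums
  open PatternCounts
  open Vec.Vec

  private
    variable
      A B : Set
      n k : ℕ

  unique-⊆⇒length≤ : {xs ys : List ℕ} → Unique xs → Unique ys → xs ⊆ ys → length xs ≤ length ys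
  unique-⊆⇒length≤ {xs} {ys} xs! ys! xs⊆ys = begin
    length xs                   ≡⟨ ↭-length (∼bag⇒↭ (unique∧set⇒bag xs! (Unique.filter⁺ (_∈? xs) ys!) (mk⇔ to from))) ⟩
    length (filter (_∈? xs) ys) ≤⟨ List.length-filter (_∈? xs) ys ⟩
    length ys                   ∎
    where
    open ≤-Reasoning
    to : ∀ {x} → x ∈ xs → x ∈ filter (_∈? xs) ys
    to x∈ = ∈-filter⁺ (_∈? xs) (xs⊆ys x∈) x∈
    from : ∀ {x} → x ∈ filter (_∈? xs) ys → x ∈ xs
    from = proj₂ ∘ ∈-filter⁻ (_∈? xs) {xs = ys}

  length≤bound : ∀ {b} {xs : List ℕ} → Unique xs → (∀ {x} → x ∈ xs → x < b) → length xs ≤ b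
  length≤bound {b} xs! bound = subst (_ ≤_) (List.length-upTo b)
    (unique-⊆⇒length≤ xs! (Unique.upTo⁺ b) (∈-upTo⁺ ∘ bound))

  unique-map⁺ : ∀ {xs : List A} (g : A → B) → (∀ {x y} → x ∈ xs → y ∈ xs → g x ≡ g y → x ≡ y) → Unique xs → Unique (map g xs)
  unique-map⁺ g inj []          = []
  unique-map⁺ g inj (x∉ ∷ xs!) = All.tabulate gx≢ ∷ unique-map⁺ g (λ a∈ b∈ → inj (there a∈) (there b∈)) xs!
    where
    gx≢ : ∀ {z} → z ∈ map g _ → g _ ≢ z
    gx≢ z∈ gx≡z with y , y∈ , refl ← ∈-map⁻ g z∈ = All.lookup x∉ y∈ (inj (here refl) (there y∈) gx≡z)

  unique-++⁻ˡ : ∀ (xs : List A) {ys} → Unique (xs ++ ys) → Unique xs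
  unique-++⁻ˡ []       _          = []
  unique-++⁻ˡ (x ∷ xs) (x∉ ∷ xs!) = All.++⁻ˡ xs x∉ ∷ unique-++⁻ˡ xs xs!

  unique-++⁻ʳ : ∀ (xs : List A) {ys} → Unique (xs ++ ys) → Unique ys
  unique-++⁻ʳ []       ys!       = ys!
  unique-++⁻ʳ (x ∷ xs) (_ ∷ xs!) = unique-++⁻ʳ xs xs!

  unique-++⇒disjoint : ∀ (xs : List A) {ys} → Unique (xs ++ ys) → Disjoint xs ys
  unique-++⇒disjoint (x ∷ xs) (x∉ ∷ _)   (here refl , x∈ys) = All.lookup x∉ (∈-++⁺ʳ xs x∈ys) refl
  unique-++⇒disjoint (x ∷ xs) (_  ∷ xs!) (there v∈xs , v∈ys) = unique-++⇒disjoint xs xs! (v∈xs , v∈ys)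

  record IsPermOf (n : ℕ) (σ : List ℕ) : Set where
    constructor isPermOf
    field
      length≡ : length σ ≡ n
      bounded : All (_< n) σ
      unique  : Unique σ

    complete : ∀ {v} → v < n → v ∈ σ
    complete {v} v<n with v ∈? σ
    ... | yes v∈σ = v∈σ
    ... | no  v∉σ = ⊥-elim (<-irrefl refl (begin-strict
      n                ≡⟨ length≡ ⟨
      length σ         <⟨ n<1+n (length σ) ⟩
      length (v ∷ σ)   ≤⟨ length≤bound (All.tabulate (λ x∈σ v≡x → v∉σ (subst (_∈ σ) (sym v≡x) x∈σ)) ∷ unique) bound ⟩
      n                ∎))
      where
      open ≤-Reasoning
      bound : ∀ {x} → x ∈ v ∷ σ → x < n
      bound (here refl) = v<n
      bound (there x∈σ) = All.lookup bounded x∈σ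

  toList-unique : ∀ (v : Vec A k) → (∀ i j → lookup v i ≡ lookup v j → i ≡ j) → Unique (toList v)
  toList-unique []      _   = []
  toList-unique (x ∷ v) inj = All.tabulate x≢ ∷ toList-unique v (λ i j eq → Fin.suc-injective (inj (Fin.suc i) (Fin.suc j) eq))
    where
    x≢ : ∀ {y} → y ∈ toList v → x ≢ y
    x≢ y∈ refl with () ← inj Fin.zero (Fin.suc (Any.index (∈-toList⁻ y∈))) (lookup-index (∈-toList⁻ y∈))

  toList-unique⁻ : ∀ (v : Vec A k) → Unique (toList v) → ∀ i j → lookup v i ≡ lookup v j → i ≡ j
  toList-unique⁻ (x ∷ v) _          Fin.zero    Fin.zero    _  = refl
  toList-unique⁻ (x ∷ v) (x∉ ∷ _)   Fin.zero    (Fin.suc j) eq = ⊥-elim (All.lookup x∉ (∈-toList⁺ (∈-lookup j v)) eq)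
  toList-unique⁻ (x ∷ v) (x∉ ∷ _)   (Fin.suc i) Fin.zero    eq = ⊥-elim (All.lookup x∉ (∈-toList⁺ (∈-lookup i v)) (sym eq))
  toList-unique⁻ (x ∷ v) (_ ∷ v!)   (Fin.suc i) (Fin.suc j) eq = cong Fin.suc (toList-unique⁻ v v! i j eq)

  words≡ : ∀ n k → words n (suc k) ≡ map (λ (i , w) → i ∷ w) (cartesianProduct (allFin n) (words n k))
  words≡ n k = go (allFin n)
    where
    go : ∀ is → concatMap (λ i → map (i ∷_) (words n k)) is ≡ map (λ (i , w) → i ∷ w) (cartesianProduct is (words n k))
    go []       = refl
    go (i ∷ is) = begin
      map (i ∷_) (words n k) ++ _                                 ≡⟨ cong₂ _++_ (List.map-∘ (words n k)) (go is) ⟩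
      map _ (map (i ,_) (words n k)) ++ map _ (cartesianProduct is (words n k)) ≡⟨ List.map-++ _ (map (i ,_) (words n k)) _ ⟨
      map (λ (i , w) → i ∷ w) (cartesianProduct (i ∷ is) (words n k)) ∎
      where open ≡-Reasoning

  words-unique : ∀ n k → Unique (words n k)
  words-unique n zero    = [] ∷ []
  words-unique n (suc k) rewrite words≡ n k =
    Unique.map⁺ (λ { {i , v} {j , w} refl → refl }) (Unique.cartesianProduct⁺ (Unique.allFin⁺ n) (words-unique n k))

  ∈-words : ∀ (v : Vec (Fin n) k) → v ∈ words n k
  ∈-words []                = here refl
  ∈-words {n} {suc k} (x ∷ v) rewrite words≡ n k =
    ∈-map⁺ (λ (i , w) → i ∷ w) (∈-cartesianProduct⁺ (∈-allFin x) (∈-words v))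

  word-injective : ∀ {v w : Vec (Fin n) k} → word v ≡ word w → v ≡ w
  word-injective {v = []}    {[]}    _  = refl
  word-injective {v = x ∷ v} {y ∷ w} eq =
    cong₂ _∷_ (toℕ-injective (List.∷-injectiveˡ eq)) (word-injective (List.∷-injectiveʳ eq))

  fromWord : ∀ (σ : List ℕ) → length σ ≡ k → All (_< n) σ → Vec (Fin n) k
  fromWord {zero}  []      _   []            = []
  fromWord {suc k} (x ∷ σ) len (x<n ∷ σ<n) = fromℕ< x<n ∷ fromWord σ (suc-injective len) σ<n

  word-fromWord : ∀ σ (len : length σ ≡ k) (σ<n : All (_< n) σ) → word (fromWord σ len σ<n) ≡ σ
  word-fromWord {zero}  []      _   []          = refl
  word-fromWord {suc k} (x ∷ σ) len (x<n ∷ σ<n) = cong₂ _∷_ (toℕ-fromℕ< x<n) (word-fromWord σ (suc-injective len) σ<n)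

  word-isPermOf : ∀ (π : Vec (Fin n) n) → IsPerm π → IsPermOf n (word π)
  word-isPermOf π π-inj = isPermOf
    (trans (List.length-map toℕ (toList π)) (Vec.length-toList π))
    (All.map⁺ (All.tabulate (λ {x} _ → toℕ<n x)))
    (Unique.map⁺ toℕ-injective (toList-unique π (λ i j → All.lookup π-inj (∈-cartesianProduct⁺ (∈-allFin i) (∈-allFin j)))))

  -- Opaque because nothing needs the enumeration of Defs beyond perms132≡, and unfolding it is costly.
  opaque
    perms132 : ℕ → ℕ → List (List ℕ)
    perms132 i n = map word (filter (λ π → #132 π ≟ i) (perms n))

    perms132≡ : ∀ i n → perms132 i n ≡ map word (filter (λ π → #132 π ≟ i) (perms n))
    perms132≡ i n = refl

  perms132-unique : ∀ i n → Unique (perms132 i n)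
  perms132-unique i n = subst Unique (sym (perms132≡ i n)) $ Unique.map⁺ word-injective (Unique.filter⁺ _ (Unique.filter⁺ _ (words-unique n n)))

  ∈-perms132⁻ : ∀ {i n σ} → σ ∈ perms132 i n → IsPermOf n σ × #132ˡ σ ≡ i
  ∈-perms132⁻ {i} {n} σ∈ with ∈-map⁻ word (subst (_ ∈_) (perms132≡ i n) σ∈)
  ... | π , π∈ , refl with ∈-filter⁻ (λ π → #132 π ≟ i) {xs = perms n} π∈
  ... | π∈perms , #132≡i = word-isPermOf π (proj₂ (∈-filter⁻ _ {xs = words n n} π∈perms)) , trans (sym (#132≡#132ˡ π)) #132≡i

  ∈-perms132⁺ : ∀ {i n σ} → IsPermOf n σ → #132ˡ σ ≡ i → σ ∈ perms132 i n
  ∈-perms132⁺ {i} {n} {σ} (isPermOf len σ<n σ!) #132≡i = subst₂ _∈_ (word-fromWord σ len σ<n) (sym (perms132≡ i n))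
    (∈-map⁺ word (∈-filter⁺ _ (∈-filter⁺ _ (∈-words π) (All.tabulate (λ {(i , j)} _ → toList-unique⁻ π π! i j)))
                               (trans (#132≡#132ˡ π) (trans (cong #132ˡ (word-fromWord σ len σ<n)) #132≡i))))
    where
    π : Vec (Fin n) n
    π = fromWord σ len σ<n
    π! : Unique (toList π)
    π! = Unique.map⁻ (subst Unique (sym (word-fromWord σ len σ<n)) σ!)

  fibre : (A → ℕ) → ℕ → List A → List A
  fibre key k = filter (λ x → key x ≟ k)

  position : ℕ → List ℕ → ℕ
  position v []       = 0
  position v (x ∷ xs) with x ≟ v
  ... | yes _ = 0
  ... | no  _ = suc (position v xs)

  position<length : ∀ {v} xs → v ∈ xs → position v xs < length xs
  position<length {v} (x ∷ xs) v∈ with x ≟ v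
  ... | yes _ = s≤s z≤n
  position<length {v} (x ∷ xs) (here refl) | no x≢v = ⊥-elim (x≢v refl)
  position<length {v} (x ∷ xs) (there v∈)  | no _   = s≤s (position<length xs v∈)

  split-at-position : ∀ {v} xs → v ∈ xs → let p = position v xs in xs ≡ take p xs ++ v ∷ drop (suc p) xs
  split-at-position {v} (x ∷ xs) v∈ with x ≟ v
  ... | yes refl = refl
  split-at-position {v} (x ∷ xs) (here refl) | no x≢v = ⊥-elim (x≢v refl)
  split-at-position {v} (x ∷ xs) (there v∈)  | no _   = cong (x ∷_) (split-at-position xs v∈)

  position-++ : ∀ {v} xs ys → v ∉ xs → position v (xs ++ v ∷ ys) ≡ length xs
  position-++ {v} []       ys v∉ with v ≟ v
  ... | yes _   = refl
  ... | no v≢v = ⊥-elim (v≢v refl)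
  position-++ {v} (x ∷ xs) ys v∉ with x ≟ v
  ... | yes refl = ⊥-elim (v∉ (here refl))
  ... | no  _    = cong suc (position-++ xs ys (v∉ ∘ there))

  take-++-∷ : ∀ (xs : List A) y ys → take (length xs) (xs ++ y ∷ ys) ≡ xs
  take-++-∷ []       y ys = refl
  take-++-∷ (x ∷ xs) y ys = cong (x ∷_) (take-++-∷ xs y ys)

  drop-++-∷ : ∀ (xs : List A) y ys → drop (suc (length xs)) (xs ++ y ∷ ys) ≡ ys
  drop-++-∷ []       y ys = refl
  drop-++-∷ (x ∷ xs) y ys = drop-++-∷ xs y ys

  isPermOf-insert-max : ∀ {top} αs βs → Unique αs → Unique βs → Disjoint αs βs → All (_< top) αs → All (_< top) βs →
                  length αs + length βs ≡ top → IsPermOf (suc top) (αs ++ top ∷ βs)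
  isPermOf-insert-max {top} αs βs αs! βs! αs#βs αs<top βs<top len = isPermOf
    (trans (List.length-++ αs) (trans (+-suc (length αs) (length βs)) (cong suc len)))
    (All.++⁺ (All.map m<n⇒m<1+n αs<top) (n<1+n top ∷ All.map m<n⇒m<1+n βs<top))
    (Unique.++⁺ αs! (All.map (λ b<top → >⇒≢ b<top) βs<top ∷ βs!) αs#top∷βs)
    where
    αs#top∷βs : Disjoint αs (top ∷ βs)
    αs#top∷βs (v∈αs , here refl)   = <-irrefl refl (All.lookup αs<top v∈αs)
    αs#top∷βs (v∈αs , there v∈βs)  = αs#βs (v∈αs , v∈βs)

  module AroundMax {top : ℕ} (α β : List ℕ) (σ-perm : IsPermOf (suc top) (α ++ top ∷ β)) where
    open IsPermOf σ-perm

    α! : Unique α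
    α! = unique-++⁻ˡ α unique

    β! : Unique β
    β! with _ ∷ β! ← unique-++⁻ʳ α unique = β!

    top∉β : top ∉ β
    top∉β with top∉ ∷ _ ← unique-++⁻ʳ α unique = λ top∈ → All.lookup top∉ top∈ refl

    α#top∷β : Disjoint α (top ∷ β)
    α#top∷β = unique-++⇒disjoint α unique

    α#β : Disjoint α β
    α#β (v∈α , v∈β) = α#top∷β (v∈α , there v∈β)

    α<top : ∀ {a} → a ∈ α → a < top
    α<top a∈ = ≤∧≢⇒< (≤-pred (All.lookup bounded (∈-++⁺ˡ a∈))) (λ { refl → α#top∷β (a∈ , here refl) })

    β<top : ∀ {b} → b ∈ β → b < top
    β<top b∈ = ≤∧≢⇒< (≤-pred (All.lookup bounded (∈-++⁺ʳ α (there b∈)))) (λ { refl → top∉β b∈ })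

    below-top : ∀ {v} → v < top → v ∈ α ⊎ v ∈ β
    below-top v<top with ∈-++⁻ α (complete (m<n⇒m<1+n v<top))
    ... | inj₁ v∈α          = inj₁ v∈α
    ... | inj₂ (here refl)  = ⊥-elim (<-irrefl refl v<top)
    ... | inj₂ (there v∈β)  = inj₂ v∈β

    length-β : ∀ {k m} → top ≡ k + m → length α ≡ k → length β ≡ m
    length-β {k} {m} refl refl = +-cancelˡ-≡ k _ _ (suc-injective (begin
      suc (k + length β)   ≡⟨ +-suc k (length β) ⟨
      k + suc (length β)   ≡⟨ List.length-++ α ⟨
      length (α ++ top ∷ β) ≡⟨ length≡ ⟩
      suc (k + m)          ∎))
      where open ≡-Reasoning

  map-shift-unshift : ∀ s (xs : List ℕ) → (∀ {x} → x ∈ xs → s ≤ x) → map (s +_) (map (_∸ s) xs) ≡ xs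
  map-shift-unshift s xs s≤ = trans (sym (List.map-∘ xs))
    (trans (List.map-cong-local (All.tabulate (λ x∈ → m+[n∸m]≡n (s≤ x∈)))) (List.map-id xs))

  swap : ℕ → ℕ → ℕ
  swap m x with x ≟ m | x ≟ suc m
  ... | yes _ | _     = suc m
  ... | no  _ | yes _ = m
  ... | no  _ | no  _ = x

  swap-≡ : ∀ m → swap m m ≡ suc m
  swap-≡ m with m ≟ m
  ... | yes _  = refl
  ... | no m≢m = ⊥-elim (m≢m refl)

  swap-suc : ∀ m → swap m (suc m) ≡ m
  swap-suc m with suc m ≟ m | suc m ≟ suc m
  ... | yes 1+m≡m | _ = ⊥-elim (1+n≢n 1+m≡m)
  ... | no  _     | yes _ = refl
  ... | no  _     | no 1+m≢1+m = ⊥-elim (1+m≢1+m refl)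

  swap-< : ∀ {m x} → x < m → swap m x ≡ x
  swap-< {m} {x} x<m with x ≟ m | x ≟ suc m
  ... | yes refl | _        = ⊥-elim (<-irrefl refl x<m)
  ... | no  _    | yes refl = ⊥-elim (<-asym x<m (n<1+n m))
  ... | no  _    | no  _    = refl

  swap-involutive : ∀ m x → swap m (swap m x) ≡ x
  swap-involutive m x with x ≟ m | x ≟ suc m
  ... | yes refl | _        = swap-suc m
  ... | no  _    | yes refl = swap-≡ m
  ... | no  x≢m  | no  x≢1+m with x ≟ m | x ≟ suc m
  ...   | yes x≡m | _         = ⊥-elim (x≢m x≡m)
  ...   | no  _   | yes x≡1+m = ⊥-elim (x≢1+m x≡1+m)
  ...   | no  _   | no  _     = refl

  swap-injective : ∀ m {x y} → swap m x ≡ swap m y → x ≡ y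
  swap-injective m {x} {y} eq = trans (sym (swap-involutive m x)) (trans (cong (swap m) eq) (swap-involutive m y))

  swap-mono : ∀ m {a b} → a < b → b ≤ m → swap m a < swap m b
  swap-mono m {a} {b} a<b b≤m with m≤n⇒m<n∨m≡n b≤m
  ... | inj₁ b<m  = subst₂ _<_ (sym (swap-< (<-trans a<b b<m))) (sym (swap-< b<m)) a<b
  ... | inj₂ refl = subst₂ _<_ (sym (swap-< a<b)) (sym (swap-≡ b)) (m<n⇒m<1+n a<b)

  swap-mono-∈ : ∀ {m β} → IsPermOf (suc m) β → ∀ {a b} → a ∈ β → b ∈ β → a < b → swap m a < swap m b
  swap-mono-∈ β-perm _ b∈ a<b = swap-mono _ a<b (≤-pred (All.lookup (IsPermOf.bounded β-perm) b∈))

  swap-≤ : ∀ m {x} → x ≤ m → swap m x ≤ suc m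
  swap-≤ m x≤m with m≤n⇒m<n∨m≡n x≤m
  ... | inj₁ x<m  = subst (_≤ suc m) (sym (swap-< x<m)) (m≤n⇒m≤1+n x≤m)
  ... | inj₂ refl = ≤-reflexive (swap-≡ _)

  swap-≢ : ∀ m {x} → x ≤ m → swap m x ≢ m
  swap-≢ m x≤m with m≤n⇒m<n∨m≡n x≤m
  ... | inj₁ x<m  = λ eq → <-irrefl (trans (sym (swap-< x<m)) eq) x<m
  ... | inj₂ refl = λ eq → 1+n≢n (trans (sym (swap-≡ _)) eq)

module Decomposition where
  open import Data.Empty using (⊥-elim)
  open import Data.List using (List; []; _∷_; _++_; map; length; take; drop; upTo; [_]; filter; cartesianProduct)
  import Data.List.Properties as List
  open import Data.List.Membership.Propositional using (_∈_; _∉_)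
  open import Data.List.Membership.Propositional.Properties
    using (∈-filter⁺; ∈-filter⁻; ∈-map⁺; ∈-map⁻; ∈-upTo⁺; ∈-upTo⁻; ∈-cartesianProduct⁺; ∈-cartesianProduct⁻;
           ∈-++⁺ˡ; ∈-++⁺ʳ; ∈-++⁻; ∈-∃++)
  open import Data.List.Relation.Binary.Disjoint.Propositional using (Disjoint)
  open import Data.List.Relation.Binary.Sublist.Propositional using ([]; _∷_; _∷ʳ_) renaming (_⊆_ to _⊑_)
  import Data.List.Relation.Binary.Sublist.Propositional as Sublist
  import Data.List.Relation.Binary.Sublist.Propositional.Properties as Sublist
  open import Data.List.Relation.Unary.All as All using (All; []; _∷_)
  import Data.List.Relation.Unary.All.Properties as All
  open import Data.List.Relation.Unary.AllPairs using ([]; _∷_)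
  open import Data.List.Relation.Unary.Any using (here; there)
  open import Data.List.Relation.Unary.Unique.Propositional using (Unique)
  import Data.List.Relation.Unary.Unique.Propositional.Properties as Unique
  open import Data.Nat using (zero; suc; _+_; _∸_; _≤_; _<_; _≟_; _≤?_; _<?_; s≤s; z≤n)
  open import Data.Nat.Properties
  open import Data.Nat.Tactic.RingSolver using (solve-∀)
  open import Data.Product using (_×_; _,_; proj₁; proj₂; ∃-syntax; uncurry)
  open import Data.Sum using (_⊎_; inj₁; inj₂)
  open import Function using (_∘_; case_of_)
  open import Relation.Binary.PropositionalEquality hiding ([_])
  open import Relation.Nullary using (¬?; yes; no)

  open ListSums
  open PatternCounts
  open PermutationLists

  +≡1 : ∀ a b → a + b ≡ 1 → (a ≡ 0 × b ≡ 1) ⊎ (a ≡ 1 × b ≡ 0)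
  +≡1 zero          b       eq = inj₁ (refl , eq)
  +≡1 (suc zero)    zero    eq = inj₂ (refl , refl)
  +≡1 (suc zero)    (suc b) ()
  +≡1 (suc (suc a)) b       ()

  no-members⇒[] : ∀ {A : Set} {xs : List A} → (∀ {x} → x ∉ xs) → xs ≡ []
  no-members⇒[] {xs = []}    _      = refl
  no-members⇒[] {xs = x ∷ _} x∉xs = ⊥-elim (x∉xs (here refl))

  module Fibre (k m : ℕ) where

    top : ℕ
    top = k + m

    prefix suffix : List ℕ → List ℕ
    prefix σ = take k σ
    suffix σ = drop (suc k) σ

    glueAB : List ℕ → List ℕ → List ℕ
    glueAB α₀ β = map (m +_) α₀ ++ top ∷ β

    module GlueAB {α₀ β} (α₀-perm : IsPermOf k α₀) (β-perm : IsPermOf m β) where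
      private
        module α₀ = IsPermOf α₀-perm
        module β = IsPermOf β-perm

      α : List ℕ
      α = map (m +_) α₀

      m≤α : ∀ {a} → a ∈ α → m ≤ a
      m≤α a∈ with _ , _ , refl ← ∈-map⁻ (m +_) a∈ = m≤m+n m _

      α<top : ∀ {a} → a ∈ α → a < top
      α<top a∈ with a₀ , a₀∈ , refl ← ∈-map⁻ (m +_) a∈ = subst (m + a₀ <_) (+-comm m k) (+-monoʳ-< m (All.lookup α₀.bounded a₀∈))

      α≻β : α ≻ β
      α≻β a∈ b∈ = <-≤-trans (All.lookup β.bounded b∈) (m≤α a∈)

      length-α : length α ≡ k
      length-α = trans (List.length-map (m +_) α₀) α₀.length≡

      top∉α : top ∉ α
      top∉α top∈ = <-irrefl refl (α<top top∈)

      isPermOf-glueAB : IsPermOf (suc top) (glueAB α₀ β)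
      isPermOf-glueAB = isPermOf-insert-max α β (Unique.map⁺ (+-cancelˡ-≡ m _ _) α₀.unique) β.unique
        (λ (v∈α , v∈β) → <-irrefl refl (α≻β v∈α v∈β))
        (All.tabulate α<top) (All.map (λ b<m → <-≤-trans b<m (m≤n+m m k)) β.bounded)
        (cong₂ _+_ length-α β.length≡)

      position≡ : position top (glueAB α₀ β) ≡ k
      position≡ = trans (position-++ α β top∉α) length-α

      prefix≡ : prefix (glueAB α₀ β) ≡ α
      prefix≡ = subst (λ j → take j (glueAB α₀ β) ≡ α) length-α (take-++-∷ α top β)

      suffix≡ : suffix (glueAB α₀ β) ≡ β
      suffix≡ = subst (λ j → drop (suc j) (glueAB α₀ β) ≡ β) length-α (drop-++-∷ α top β)

      private
        module Shift = Relabel (m +_) α₀ (λ _ _ → +-monoʳ-< m)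
        α<top′ : All (_< top) α
        α<top′ = All.tabulate α<top
        β<top : All (_< top) β
        β<top = All.tabulate (λ b∈ → <-≤-trans (All.lookup β.bounded b∈) (m≤n+m m k))

      crossing≡0 : #12ˡ-across α β ≡ 0
      crossing≡0 = ∑≡0 α (λ a∈ → ∑≡0 β (λ b∈ → is12-≥ (<⇒≤ (α≻β a∈ b∈))))

      #12ˡ-glueAB : #12ˡ (glueAB α₀ β) ≡ k + (#12ˡ α₀ + #12ˡ β)
      #12ˡ-glueAB = begin
        #12ˡ (α ++ top ∷ β)     ≡⟨ #12ˡ-insert-max α<top′ β<top ⟩
        length α + #12ˡ (α ++ β) ≡⟨ cong₂ _+_ length-α (#12ˡ-++ α β α≻β) ⟩
        k + (#12ˡ α + #12ˡ β)   ≡⟨ cong (λ c → k + (c + #12ˡ β)) Shift.#12ˡ-map ⟩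
        k + (#12ˡ α₀ + #12ˡ β)  ∎
        where open ≡-Reasoning

      #123ˡ-glueAB : #123ˡ (glueAB α₀ β) ≡ #12ˡ α₀ + (#123ˡ α₀ + #123ˡ β)
      #123ˡ-glueAB = begin
        #123ˡ (α ++ top ∷ β)      ≡⟨ #123ˡ-insert-max α<top′ β<top ⟩
        #12ˡ α + #123ˡ (α ++ β)   ≡⟨ cong₂ _+_ Shift.#12ˡ-map (#123ˡ-++ α β α≻β) ⟩
        #12ˡ α₀ + (#123ˡ α + #123ˡ β) ≡⟨ cong (λ c → #12ˡ α₀ + (c + #123ˡ β)) Shift.#123ˡ-map ⟩
        #12ˡ α₀ + (#123ˡ α₀ + #123ˡ β) ∎
        where open ≡-Reasoning

      #132ˡ-glueAB : #132ˡ (glueAB α₀ β) ≡ #132ˡ α₀ + #132ˡ β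
      #132ˡ-glueAB = begin
        #132ˡ (α ++ top ∷ β)             ≡⟨ #132ˡ-insert-max α<top′ β<top ⟩
        #12ˡ-across α β + #132ˡ (α ++ β)  ≡⟨ cong₂ _+_ crossing≡0 (#132ˡ-++ α β α≻β) ⟩
        #132ˡ α + #132ˡ β                ≡⟨ cong (_+ #132ˡ β) Shift.#132ˡ-map ⟩
        #132ˡ α₀ + #132ˡ β               ∎
        where open ≡-Reasoning

    module SplitAB {α β} (σ-perm : IsPermOf (suc top) (α ++ top ∷ β)) (length-α : length α ≡ k)
                   (no-crossing : #12ˡ-across α β ≡ 0) where
      open AroundMax α β σ-perm

      length-β′ : length β ≡ m
      length-β′ = length-β refl length-α

      α≻β : α ≻ β
      α≻β {a} {b} a∈ b∈ = ≤∧≢⇒< (is12≡0⇒≥ (∑≡0⇒ (is12 a) (∑≡0⇒ (λ x → ∑ β (is12 x)) no-crossing a∈) b∈))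
                                 (λ { refl → α#β (a∈ , b∈) })

      β<m : ∀ {b} → b ∈ β → b < m
      β<m {b} b∈ = begin
        suc b                 ≡⟨ cong suc (List.length-upTo b) ⟨
        length (b ∷ upTo b)   ≤⟨ unique-⊆⇒length≤ (b∉ ∷ Unique.upTo⁺ b) β! b∷below⊆β ⟩
        length β              ≡⟨ length-β′ ⟩
        m                     ∎
        where
        open ≤-Reasoning
        b∉ : All (b ≢_) (upTo b)
        b∉ = All.tabulate (λ v∈ → >⇒≢ (∈-upTo⁻ v∈))
        b∷below⊆β : ∀ {v} → v ∈ b ∷ upTo b → v ∈ β
        b∷below⊆β (here refl) = b∈
        b∷below⊆β (there v∈) with below-top (<-trans (∈-upTo⁻ v∈) (β<top b∈))
        ... | inj₁ v∈α = ⊥-elim (<-asym (∈-upTo⁻ v∈) (α≻β v∈α b∈))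
        ... | inj₂ v∈β = v∈β

      m≤α : ∀ {a} → a ∈ α → m ≤ a
      m≤α {a} a∈ = ≤-pred (begin
        suc m                ≡⟨ cong suc length-β′ ⟨
        length (a ∷ β)       ≤⟨ length≤bound (All.tabulate (λ b∈ a≡b → α#β (a∈ , subst (_∈ β) (sym a≡b) b∈)) ∷ β!) a∷β≤a ⟩
        suc a                ∎)
        where
        open ≤-Reasoning
        a∷β≤a : ∀ {v} → v ∈ a ∷ β → v < suc a
        a∷β≤a (here refl) = n<1+n a
        a∷β≤a (there b∈)  = m<n⇒m<1+n (α≻β a∈ b∈)

      α₀ : List ℕ
      α₀ = map (_∸ m) α

      α≡ : map (m +_) α₀ ≡ α
      α≡ = map-shift-unshift m α m≤α

      α₀-perm : IsPermOf k α₀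
      α₀-perm = isPermOf (trans (List.length-map (_∸ m) α) length-α)
        (All.map⁺ (All.tabulate (λ a∈ → subst (_ <_) (m+n∸n≡m k m) (∸-monoˡ-< (α<top a∈) (m≤α a∈)))))
        (Unique.map⁻ (subst Unique (sym α≡) α!))

      β-perm : IsPermOf m β
      β-perm = isPermOf length-β′ (All.tabulate β<m) β!

      σ≡ : α ++ top ∷ β ≡ glueAB α₀ β
      σ≡ = cong (_++ top ∷ β) (sym α≡)

  module FibreC (k′ m′ : ℕ) where
    open Fibre (suc k′) (suc m′) public

    top≡ : top ≡ suc (suc m′) + k′
    top≡ = cong suc (trans (+-suc k′ m′) (cong suc (+-comm k′ m′)))

    -- The only 132 of glueC α₀ β₀ is (m′, top, suc m′).
    glueC : List ℕ → List ℕ → List ℕ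
    glueC α₀ β₀ = (map (suc (suc m′) +_) α₀ ++ [ m′ ]) ++ top ∷ map (swap m′) β₀

    module GlueC {α₀ β₀} (α₀-perm : IsPermOf k′ α₀) (β₀-perm : IsPermOf (suc m′) β₀) where
      private
        module α₀ = IsPermOf α₀-perm
        module β₀ = IsPermOf β₀-perm

      S α β : List ℕ
      S = map (suc (suc m′) +_) α₀
      α = S ++ [ m′ ]
      β = map (swap m′) β₀

      β≤1+m′ : ∀ {b} → b ∈ β → b ≤ suc m′
      β≤1+m′ b∈ with b₀ , b₀∈ , refl ← ∈-map⁻ (swap m′) b∈ = swap-≤ m′ (≤-pred (All.lookup β₀.bounded b₀∈))

      m′∉β : m′ ∉ β
      m′∉β m′∈ with b₀ , b₀∈ , eq ← ∈-map⁻ (swap m′) m′∈ = swap-≢ m′ (≤-pred (All.lookup β₀.bounded b₀∈)) (sym eq)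

      2+m′≤S : ∀ {a} → a ∈ S → suc (suc m′) ≤ a
      2+m′≤S a∈ with _ , _ , refl ← ∈-map⁻ (suc (suc m′) +_) a∈ = m≤m+n _ _

      S≻m′∷β : S ≻ (m′ ∷ β)
      S≻m′∷β a∈ (here refl) = <-≤-trans (n<1+n m′) (≤-trans (n≤1+n _) (2+m′≤S a∈))
      S≻m′∷β a∈ (there b∈)  = <-≤-trans (s≤s (β≤1+m′ b∈)) (2+m′≤S a∈)

      S<top : ∀ {a} → a ∈ S → a < top
      S<top a∈ with a₀ , a₀∈ , refl ← ∈-map⁻ (suc (suc m′) +_) a∈ =
        subst (suc (suc m′) + a₀ <_) (sym top≡) (+-monoʳ-< (suc (suc m′)) (All.lookup α₀.bounded a₀∈))

      2+m′≤top : suc (suc m′) ≤ top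
      2+m′≤top = subst (suc (suc m′) ≤_) (sym top≡) (m≤m+n _ k′)

      α<top : All (_< top) α
      α<top = All.++⁺ (All.tabulate S<top) (m′<top ∷ [])
        where
        m′<top : m′ < top
        m′<top = <-≤-trans (n<1+n m′) (≤-trans (n≤1+n _) 2+m′≤top)

      β<top : All (_< top) β
      β<top = All.tabulate (λ b∈ → <-≤-trans (s≤s (β≤1+m′ b∈)) 2+m′≤top)

      S! : Unique S
      S! = Unique.map⁺ (+-cancelˡ-≡ (suc (suc m′)) _ _) α₀.unique

      α! : Unique α
      α! = Unique.++⁺ S! ([] ∷ []) (λ { (v∈S , here refl) → <-irrefl refl (S≻m′∷β v∈S (here refl)) })

      β! : Unique β
      β! = Unique.map⁺ (swap-injective m′) β₀.unique

      α#β : Disjoint α β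
      α#β (v∈α , v∈β) with ∈-++⁻ S v∈α
      ... | inj₁ v∈S         = <-irrefl refl (S≻m′∷β v∈S (there v∈β))
      ... | inj₂ (here refl) = m′∉β v∈β

      length-α : length α ≡ suc k′
      length-α = trans (List.length-++ S) (trans (cong (_+ 1) (trans (List.length-map _ α₀) α₀.length≡)) (+-comm k′ 1))

      length-β : length β ≡ suc m′
      length-β = trans (List.length-map (swap m′) β₀) β₀.length≡

      isPermOf-glueC : IsPermOf (suc top) (glueC α₀ β₀)
      isPermOf-glueC = isPermOf-insert-max α β α! β! α#β α<top β<top (trans (cong₂ _+_ length-α length-β) refl)

      top∉α : top ∉ α
      top∉α top∈ = <-irrefl refl (All.lookup α<top top∈)

      position≡ : position top (glueC α₀ β₀) ≡ suc k′
      position≡ = trans (position-++ α β top∉α) length-α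

      prefix≡ : prefix (glueC α₀ β₀) ≡ α
      prefix≡ = subst (λ j → take j (glueC α₀ β₀) ≡ α) length-α (take-++-∷ α top β)

      suffix≡ : suffix (glueC α₀ β₀) ≡ β
      suffix≡ = subst (λ j → drop (suc j) (glueC α₀ β₀) ≡ β) length-α (drop-++-∷ α top β)

      ∑β-is12-m′ : ∑ β (is12 m′) ≡ 1
      ∑β-is12-m′ = trans (∑-map (swap m′) β₀ (is12 m′))
        (∑-single (is12 m′ ∘ swap m′) β₀.unique (β₀.complete (n<1+n m′)) others
                  (trans (cong (is12 m′) (swap-≡ m′)) (is12-< (n<1+n m′))))
        where
        others : ∀ {b} → b ∈ β₀ → b ≢ m′ → is12 m′ (swap m′ b) ≡ 0
        others b∈ b≢m′ with b<m′ ← ≤∧≢⇒< (≤-pred (All.lookup β₀.bounded b∈)) b≢m′ =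
          trans (cong (is12 m′) (swap-< b<m′)) (is12-≥ (<⇒≤ b<m′))

      crossing≡1 : #12ˡ-across α β ≡ 1
      crossing≡1 = begin
        #12ˡ-across (S ++ [ m′ ]) β          ≡⟨ ∑-++ S [ m′ ] _ ⟩
        #12ˡ-across S β + (∑ β (is12 m′) + 0) ≡⟨ cong₂ (λ a b → a + (b + 0)) S-crossing ∑β-is12-m′ ⟩
        1                                   ∎
        where
        open ≡-Reasoning
        S-crossing : #12ˡ-across S β ≡ 0
        S-crossing = ∑≡0 S (λ a∈ → ∑≡0 β (λ b∈ → is12-≥ (<⇒≤ (S≻m′∷β a∈ (there b∈)))))

      private
        module Shift = Relabel (suc (suc m′) +_) α₀ (λ _ _ → +-monoʳ-< (suc (suc m′)))
        module Swap = Relabel (swap m′) β₀ (swap-mono-∈ β₀-perm)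

        α++β≡ : α ++ β ≡ S ++ m′ ∷ β
        α++β≡ = List.++-assoc S [ m′ ] β

        S≻m′ : S ≻ [ m′ ]
        S≻m′ a∈ (here refl) = S≻m′∷β a∈ (here refl)

        #12ˡ-α : #12ˡ α ≡ #12ˡ α₀
        #12ˡ-α = trans (#12ˡ-++ S [ m′ ] S≻m′) (trans (+-identityʳ _) Shift.#12ˡ-map)

        above-m′ : ∀ {y} → y ∈ β → m′ < y → ∀ {z} → z ∈ β → z ≤ y
        above-m′ y∈ m′<y z∈ = ≤-trans (β≤1+m′ z∈) m′<y

        ∑-pairs-is123-m′ : ∑-pairs (is123 m′) β ≡ 0
        ∑-pairs-is123-m′ = ∑-pairs≡0 β λ {y} {z} y∈ z∈ → case y ≤? m′ of λ where
          (yes y≤m′) → is123-≥ˡ {z = z} y≤m′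
          (no  y≰m′) → is123-≥ʳ (above-m′ y∈ (≰⇒> y≰m′) z∈)

        ∑-pairs-is132-m′ : ∑-pairs (is132 m′) β ≡ 0
        ∑-pairs-is132-m′ = ∑-pairs≡0 β λ {y} {z} y∈ z∈ → case z ≤? m′ of λ where
          (yes z≤m′) → is132-≥ˡ {y = y} z≤m′
          (no  z≰m′) → is132-≥ʳ (above-m′ z∈ (≰⇒> z≰m′) y∈)

      #12ˡ-glueC : #12ˡ (glueC α₀ β₀) ≡ suc (suc k′) + (#12ˡ α₀ + #12ˡ β₀)
      #12ˡ-glueC = begin
        #12ˡ (α ++ top ∷ β)                      ≡⟨ #12ˡ-insert-max α<top β<top ⟩
        length α + #12ˡ (α ++ β)                 ≡⟨ cong₂ _+_ length-α (cong #12ˡ α++β≡) ⟩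
        suc k′ + #12ˡ (S ++ m′ ∷ β)              ≡⟨ cong (suc k′ +_) (#12ˡ-++ S (m′ ∷ β) S≻m′∷β) ⟩
        suc k′ + (#12ˡ S + (∑ β (is12 m′) + #12ˡ β)) ≡⟨ cong₂ (λ a b → suc k′ + (a + b)) Shift.#12ˡ-map (cong₂ _+_ ∑β-is12-m′ Swap.#12ˡ-map) ⟩
        suc k′ + (#12ˡ α₀ + (1 + #12ˡ β₀))       ≡⟨ shuffle k′ (#12ˡ α₀) (#12ˡ β₀) ⟩
        suc (suc k′) + (#12ˡ α₀ + #12ˡ β₀)       ∎
        where
        open ≡-Reasoning
        shuffle : ∀ a b c → suc a + (b + (1 + c)) ≡ suc (suc a) + (b + c)
        shuffle = solve-∀

      #123ˡ-glueC : #123ˡ (glueC α₀ β₀) ≡ #12ˡ α₀ + (#123ˡ α₀ + #123ˡ β₀)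
      #123ˡ-glueC = begin
        #123ˡ (α ++ top ∷ β)                     ≡⟨ #123ˡ-insert-max α<top β<top ⟩
        #12ˡ α + #123ˡ (α ++ β)                  ≡⟨ cong₂ _+_ #12ˡ-α (cong #123ˡ α++β≡) ⟩
        #12ˡ α₀ + #123ˡ (S ++ m′ ∷ β)            ≡⟨ cong (#12ˡ α₀ +_) (#123ˡ-++ S (m′ ∷ β) S≻m′∷β) ⟩
        #12ˡ α₀ + (#123ˡ S + (∑-pairs (is123 m′) β + #123ˡ β))
          ≡⟨ cong₂ (λ a b → #12ˡ α₀ + (a + b)) Shift.#123ˡ-map (cong₂ _+_ ∑-pairs-is123-m′ Swap.#123ˡ-map) ⟩
        #12ˡ α₀ + (#123ˡ α₀ + #123ˡ β₀)          ∎
        where open ≡-Reasoning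

      #132ˡ-glueC : #132ˡ (glueC α₀ β₀) ≡ suc (#132ˡ α₀ + #132ˡ β₀)
      #132ˡ-glueC = begin
        #132ˡ (α ++ top ∷ β)                     ≡⟨ #132ˡ-insert-max α<top β<top ⟩
        #12ˡ-across α β + #132ˡ (α ++ β)          ≡⟨ cong₂ _+_ crossing≡1 (cong #132ˡ α++β≡) ⟩
        1 + #132ˡ (S ++ m′ ∷ β)                  ≡⟨ cong (1 +_) (#132ˡ-++ S (m′ ∷ β) S≻m′∷β) ⟩
        1 + (#132ˡ S + (∑-pairs (is132 m′) β + #132ˡ β))
          ≡⟨ cong₂ (λ a b → 1 + (a + b)) Shift.#132ˡ-map (cong₂ _+_ ∑-pairs-is132-m′ Swap.#132ˡ-map) ⟩
        suc (#132ˡ α₀ + #132ˡ β₀)                ∎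
        where open ≡-Reasoning

    module SplitC {α β} (σ-perm : IsPermOf (suc top) (α ++ top ∷ β)) (length-α : length α ≡ suc k′)
                  (one : #132ˡ (α ++ top ∷ β) ≡ 1) (crossing≢0 : #12ˡ-across α β ≢ 0) where
      open AroundMax α β σ-perm

      length-β′ : length β ≡ suc m′
      length-β′ = length-β refl length-α

      private
        split-one : #12ˡ-across α β ≡ 1 × #132ˡ (α ++ β) ≡ 0
        split-one with +≡1 (#12ˡ-across α β) _ (trans (sym (#132ˡ-insert-max (All.tabulate α<top) (All.tabulate β<top))) one)
        ... | inj₁ (crossing≡0 , _) = ⊥-elim (crossing≢0 crossing≡0)
        ... | inj₂ split            = split

      crossing≡1 : #12ˡ-across α β ≡ 1
      crossing≡1 = proj₁ split-one

      #132ˡ-α++β : #132ˡ (α ++ β) ≡ 0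
      #132ˡ-α++β = proj₂ split-one

      private
        x₀-witness : ∃[ x ] x ∈ α × ∑ β (is12 x) ≢ 0
        x₀-witness = ∑≢0⇒ α _ crossing≢0
        y₀-witness : ∃[ y ] y ∈ β × is12 (proj₁ x₀-witness) y ≢ 0
        y₀-witness = ∑≢0⇒ β _ (proj₂ (proj₂ x₀-witness))

      x₀ y₀ : ℕ
      x₀ = proj₁ x₀-witness
      y₀ = proj₁ y₀-witness

      x₀∈α : x₀ ∈ α
      x₀∈α = proj₁ (proj₂ x₀-witness)

      y₀∈β : y₀ ∈ β
      y₀∈β = proj₁ (proj₂ y₀-witness)

      x₀<y₀ : x₀ < y₀
      x₀<y₀ = is12≢0⇒< (proj₂ (proj₂ y₀-witness))

      -- A second crossing pair would be a second 132 with top in the middle.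
      β-small : ∀ {y} → y ∈ β → y ≢ y₀ → y < x₀
      β-small {y} y∈ y≢y₀ with y <? x₀
      ... | yes y<x₀ = y<x₀
      ... | no  y≮x₀ = ⊥-elim (<⇒≱ (s≤s (s≤s z≤n)) (begin
        2                             ≤⟨ 2≤∑ (is12 x₀) β! y₀∈β y∈ (y≢y₀ ∘ sym) (1≤is12 x₀<y₀) (1≤is12 x₀<y) ⟩
        ∑ β (is12 x₀)                 ≤⟨ term≤∑ (λ x → ∑ β (is12 x)) x₀∈α ⟩
        #12ˡ-across α β                ≡⟨ crossing≡1 ⟩
        1                             ∎))
        where
        open ≤-Reasoning
        x₀<y : x₀ < y
        x₀<y = ≤∧≢⇒< (≮⇒≥ y≮x₀) (λ { refl → α#β (x₀∈α , y∈) })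

      α-large : ∀ {x} → x ∈ α → x ≢ x₀ → y₀ < x
      α-large {x} x∈ x≢x₀ with y₀ <? x
      ... | yes y₀<x = y₀<x
      ... | no  y₀≮x = ⊥-elim (<⇒≱ (s≤s (s≤s z≤n)) (begin
        2                             ≤⟨ 2≤∑ (λ x → is12 x y₀) α! x₀∈α x∈ (x≢x₀ ∘ sym) (1≤is12 x₀<y₀) (1≤is12 x<y₀) ⟩
        ∑ α (λ x → is12 x y₀)         ≤⟨ ∑-mono α (λ x → term≤∑ (is12 x) y₀∈β) ⟩
        #12ˡ-across α β                ≡⟨ crossing≡1 ⟩
        1                             ∎))
        where
        open ≤-Reasoning
        x<y₀ : x < y₀
        x<y₀ = ≤∧≢⇒< (≮⇒≥ y₀≮x) (λ { refl → α#β (x∈ , y₀∈β) })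

      private
        x₀∉β : x₀ ∉ β
        x₀∉β x₀∈β = α#β (x₀∈α , x₀∈β)

        β⊆y₀∷below-x₀ : ∀ {y} → y ∈ β → y ∈ y₀ ∷ upTo x₀
        β⊆y₀∷below-x₀ {y} y∈ with y ≟ y₀
        ... | yes refl = here refl
        ... | no  y≢y₀ = there (∈-upTo⁺ (β-small y∈ y≢y₀))

        below-y₀⊆x₀∷β : ∀ {v} → v ∈ y₀ ∷ upTo y₀ → v ∈ x₀ ∷ β
        below-y₀⊆x₀∷β (here refl) = there y₀∈β
        below-y₀⊆x₀∷β {v} (there v∈) with below-top (<-trans (∈-upTo⁻ v∈) (β<top y₀∈β))
        ... | inj₂ v∈β = there v∈β
        ... | inj₁ v∈α with v ≟ x₀
        ...   | yes refl = here refl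
        ...   | no  v≢x₀ = ⊥-elim (<-asym (∈-upTo⁻ v∈) (α-large v∈α v≢x₀))

        x₀∷β≤y₀ : ∀ {v} → v ∈ x₀ ∷ β → v < suc y₀
        x₀∷β≤y₀ (here refl) = m<n⇒m<1+n x₀<y₀
        x₀∷β≤y₀ {y} (there y∈) with y ≟ y₀
        ... | yes refl = n<1+n y₀
        ... | no  y≢y₀ = m<n⇒m<1+n (<-trans (β-small y∈ y≢y₀) x₀<y₀)

        x₀∷β! : Unique (x₀ ∷ β)
        x₀∷β! = All.tabulate (λ y∈ x₀≡y → x₀∉β (subst (_∈ β) (sym x₀≡y) y∈)) ∷ β!

      y₀≡1+m′ : y₀ ≡ suc m′
      y₀≡1+m′ = ≤-antisym (≤-pred (begin
          suc y₀                 ≡⟨ cong suc (List.length-upTo y₀) ⟨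
          length (y₀ ∷ upTo y₀)  ≤⟨ unique-⊆⇒length≤ (All.tabulate (>⇒≢ ∘ ∈-upTo⁻) ∷ Unique.upTo⁺ y₀) x₀∷β! below-y₀⊆x₀∷β ⟩
          length (x₀ ∷ β)        ≡⟨ cong suc length-β′ ⟩
          suc (suc m′)           ∎))
        (≤-pred (begin
          suc (suc m′)           ≡⟨ cong suc length-β′ ⟨
          length (x₀ ∷ β)        ≤⟨ length≤bound x₀∷β! x₀∷β≤y₀ ⟩
          suc y₀                 ∎))
        where open ≤-Reasoning

      x₀≡m′ : x₀ ≡ m′
      x₀≡m′ = ≤-antisym (≤-pred (subst (x₀ <_) y₀≡1+m′ x₀<y₀)) (≤-pred (begin
          suc m′                 ≡⟨ length-β′ ⟨
          length β               ≤⟨ unique-⊆⇒length≤ β! (All.tabulate (>⇒≢ ∘ x₀<upTo) ∷ Unique.upTo⁺ x₀) β⊆y₀∷below-x₀ ⟩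
          length (y₀ ∷ upTo x₀)  ≡⟨ cong suc (List.length-upTo x₀) ⟩
          suc x₀                 ∎))
        where
        open ≤-Reasoning
        x₀<upTo : ∀ {v} → v ∈ upTo x₀ → v < y₀
        x₀<upTo v∈ = <-trans (∈-upTo⁻ v∈) x₀<y₀

      x₀-last : ∃[ L ] α ≡ L ++ [ x₀ ]
      x₀-last with ∈-∃++ x₀∈α
      ... | L , []    , α≡ = L , α≡
      ... | L , b ∷ R , α≡ = ⊥-elim (<⇒≱ (s≤s z≤n) (begin
        1                      ≡⟨ is132≡1 x₀<y₀ (α-large b∈α b≢x₀) ⟨
        is132 x₀ b y₀          ≤⟨ occurrence≤∑-triples is132 x₀by₀⊑ ⟩
        #132ˡ (α ++ β)         ≡⟨ #132ˡ-α++β ⟩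
        0                      ∎))
        where
        open ≤-Reasoning
        b∈α : b ∈ α
        b∈α = subst (b ∈_) (sym α≡) (∈-++⁺ʳ L (there (here refl)))
        b≢x₀ : b ≢ x₀
        b≢x₀ with x₀∉ ∷ _ ← unique-++⁻ʳ L (subst Unique α≡ α!) = λ b≡x₀ → All.lookup x₀∉ (here refl) (sym b≡x₀)
        x₀by₀⊑ : (x₀ ∷ b ∷ y₀ ∷ []) ⊑ α ++ β
        x₀by₀⊑ = subst ((x₀ ∷ b ∷ y₀ ∷ []) ⊑_) (sym (trans (cong (_++ β) α≡) (List.++-assoc L (x₀ ∷ b ∷ R) β)))
                       (Sublist.++⁺ˡ L (refl ∷ refl ∷ Sublist.++⁺ˡ R (Sublist.from∈ y₀∈β)))

      L : List ℕ
      L = proj₁ x₀-last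

      α≡L++m′ : α ≡ L ++ [ m′ ]
      α≡L++m′ = trans (proj₂ x₀-last) (cong (λ x → L ++ [ x ]) x₀≡m′)

      private
        L⊆α : ∀ {x} → x ∈ L → x ∈ α
        L⊆α x∈ = subst (_ ∈_) (sym α≡L++m′) (∈-++⁺ˡ x∈)

        2+m′≤L : ∀ {x} → x ∈ L → suc (suc m′) ≤ x
        2+m′≤L {x} x∈ = subst (_< x) y₀≡1+m′ (α-large (L⊆α x∈) x≢x₀)
          where
          x≢x₀ : x ≢ x₀
          x≢x₀ refl = unique-++⇒disjoint L (subst Unique (proj₂ x₀-last) α!) (x∈ , here refl)

        length-L : length L ≡ k′
        length-L = suc-injective (begin
          suc (length L)       ≡⟨ +-comm (length L) 1 ⟨
          length L + 1         ≡⟨ List.length-++ L ⟨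
          length (L ++ [ m′ ]) ≡⟨ cong length α≡L++m′ ⟨
          length α             ≡⟨ length-α ⟩
          suc k′               ∎)
          where open ≡-Reasoning

        β₀<1+m′ : ∀ {y} → y ∈ β → swap m′ y < suc m′
        β₀<1+m′ {y} y∈ with y ≟ y₀
        ... | yes refl = subst (_< suc m′) (sym (trans (cong (swap m′) y₀≡1+m′) (swap-suc m′))) (n<1+n m′)
        ... | no  y≢y₀ = subst (_< suc m′) (sym (swap-< y<m′)) (m<n⇒m<1+n y<m′)
          where
          y<m′ : y < m′
          y<m′ = subst (y <_) x₀≡m′ (β-small y∈ y≢y₀)

      α₀ β₀ : List ℕ
      α₀ = map (_∸ suc (suc m′)) L
      β₀ = map (swap m′) β

      L≡ : map (suc (suc m′) +_) α₀ ≡ L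
      L≡ = map-shift-unshift (suc (suc m′)) L 2+m′≤L

      β≡ : map (swap m′) β₀ ≡ β
      β≡ = trans (sym (List.map-∘ β)) (trans (List.map-cong (swap-involutive m′) β) (List.map-id β))

      α₀-perm : IsPermOf k′ α₀
      α₀-perm = isPermOf (trans (List.length-map _ L) length-L)
        (All.map⁺ (All.tabulate (λ x∈ → subst (_ <_) (trans (cong (_∸ suc (suc m′)) top≡) (m+n∸m≡n (suc (suc m′)) k′))
                                                    (∸-monoˡ-< (α<top (L⊆α x∈)) (2+m′≤L x∈)))))
        (Unique.map⁻ (subst Unique (sym L≡) (unique-++⁻ˡ L (subst Unique α≡L++m′ α!))))

      β₀-perm : IsPermOf (suc m′) β₀
      β₀-perm = isPermOf (trans (List.length-map _ β) length-β′) (All.map⁺ (All.tabulate β₀<1+m′))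
                         (Unique.map⁺ (swap-injective m′) β!)

      σ≡ : α ++ top ∷ β ≡ glueC α₀ β₀
      σ≡ = cong₂ (λ a b → a ++ top ∷ b) (trans α≡L++m′ (cong (_++ [ m′ ]) (sym L≡))) (sym β≡)

      #132ˡ-α₀ : #132ˡ α₀ ≡ 0
      #132ˡ-α₀ = n≤0⇒n≡0 (begin
        #132ˡ α₀                           ≡⟨ Relabel.#132ˡ-map (suc (suc m′) +_) α₀ (λ _ _ → +-monoʳ-< (suc (suc m′))) ⟨
        #132ˡ (map (suc (suc m′) +_) α₀)   ≡⟨ cong #132ˡ L≡ ⟩
        #132ˡ L                            ≤⟨ ∑-triples-⊑ is132 L⊑α++β ⟩
        #132ˡ (α ++ β)                     ≡⟨ #132ˡ-α++β ⟩
        0                                  ∎)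
        where
        open ≤-Reasoning
        L⊑α++β : L ⊑ α ++ β
        L⊑α++β = subst (λ a → L ⊑ a ++ β) (sym α≡L++m′)
                       (subst (L ⊑_) (sym (List.++-assoc L [ m′ ] β)) (Sublist.++⁺ʳ ([ m′ ] ++ β) Sublist.⊆-refl))

      #132ˡ-β₀ : #132ˡ β₀ ≡ 0
      #132ˡ-β₀ = n≤0⇒n≡0 (begin
        #132ˡ β₀                  ≡⟨ Relabel.#132ˡ-map (swap m′) β₀ (swap-mono-∈ β₀-perm) ⟨
        #132ˡ (map (swap m′) β₀)  ≡⟨ cong #132ˡ β≡ ⟩
        #132ˡ β                   ≤⟨ ∑-triples-⊑ is132 (Sublist.++⁺ˡ α Sublist.⊆-refl) ⟩
        #132ˡ (α ++ β)            ≡⟨ #132ˡ-α++β ⟩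
        0                         ∎)
        where open ≤-Reasoning

  module Pieces (k m : ℕ) where
    open Fibre k m

    crossing : List ℕ → ℕ
    crossing σ = #12ˡ-across (prefix σ) (suffix σ)

    Fib uncrossed crossed pieceA pieceB : List (List ℕ)
    Fib       = fibre (position top) k (perms132 1 (suc top))
    uncrossed = filter (λ σ → crossing σ ≟ 0) Fib
    crossed   = filter (¬? ∘ (λ σ → crossing σ ≟ 0)) Fib
    pieceA    = filter (λ σ → #132ˡ (suffix σ) ≟ 1) uncrossed
    pieceB    = filter (¬? ∘ (λ σ → #132ˡ (suffix σ) ≟ 1)) uncrossed

    Fib-unique : Unique Fib
    Fib-unique = Unique.filter⁺ _ (perms132-unique 1 (suc top))

    ∈-Fib⁻ : ∀ {σ} → σ ∈ Fib → IsPermOf (suc top) σ × #132ˡ σ ≡ 1 × σ ≡ prefix σ ++ top ∷ suffix σ × length (prefix σ) ≡ k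
    ∈-Fib⁻ {σ} σ∈ with σ∈perms , position≡k ← ∈-filter⁻ (λ σ → position top σ ≟ k) {xs = perms132 1 (suc top)} σ∈
                   with σ-perm , one ← ∈-perms132⁻ σ∈perms =
      σ-perm , one , subst (λ p → σ ≡ take p σ ++ top ∷ drop (suc p) σ) position≡k (split-at-position σ top∈σ) ,
      trans (List.length-take k σ) (m≤n⇒m⊓n≡m (<⇒≤ (subst (_< length σ) position≡k (position<length σ top∈σ))))
      where
      top∈σ : top ∈ σ
      top∈σ = IsPermOf.complete σ-perm (n<1+n top)

    ∈-Fib⁺ : ∀ {σ} → IsPermOf (suc top) σ → #132ˡ σ ≡ 1 → position top σ ≡ k → σ ∈ Fib
    ∈-Fib⁺ σ-perm one position≡k = ∈-filter⁺ (λ σ → position top σ ≟ k) (∈-perms132⁺ σ-perm one) position≡k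

    pairsAB : ℕ → ℕ → List (List ℕ × List ℕ)
    pairsAB i j = cartesianProduct (perms132 i k) (perms132 j m)

    glueAB-∈ : ∀ {i j α₀ β} → i + j ≡ 1 → α₀ ∈ perms132 i k → β ∈ perms132 j m →
               glueAB α₀ β ∈ uncrossed × #132ˡ (suffix (glueAB α₀ β)) ≡ j
    glueAB-∈ i+j≡1 α₀∈ β∈ with α₀-perm , #132-α₀ ← ∈-perms132⁻ α₀∈ | β-perm , #132-β ← ∈-perms132⁻ β∈ =
      ∈-filter⁺ (λ σ → crossing σ ≟ 0)
        (∈-Fib⁺ isPermOf-glueAB (trans #132ˡ-glueAB (trans (cong₂ _+_ #132-α₀ #132-β) i+j≡1)) position≡)
        (trans (cong₂ #12ˡ-across prefix≡ suffix≡) crossing≡0) ,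
      trans (cong #132ˡ suffix≡) #132-β
      where open GlueAB α₀-perm β-perm

    glueAB-injective : ∀ {i j p p′} → p ∈ pairsAB i j → p′ ∈ pairsAB i j → uncurry glueAB p ≡ uncurry glueAB p′ → p ≡ p′
    glueAB-injective {p = α₀ , β} {α₀′ , β′} p∈ p′∈ eq
      with α₀∈ , β∈ ← ∈-cartesianProduct⁻ (perms132 _ k) (perms132 _ m) p∈
         | α₀′∈ , β′∈ ← ∈-cartesianProduct⁻ (perms132 _ k) (perms132 _ m) p′∈ =
      cong₂ _,_ (List.map-injective (+-cancelˡ-≡ m _ _) (trans (sym G.prefix≡) (trans (cong prefix eq) G′.prefix≡)))
                (trans (sym G.suffix≡) (trans (cong suffix eq) G′.suffix≡))
      where
      module G  = GlueAB (proj₁ (∈-perms132⁻ α₀∈))  (proj₁ (∈-perms132⁻ β∈))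
      module G′ = GlueAB (proj₁ (∈-perms132⁻ α₀′∈)) (proj₁ (∈-perms132⁻ β′∈))

    record UncrossedSplit (σ : List ℕ) : Set where
      field
        α₀ β    : List ℕ
        σ≡      : σ ≡ glueAB α₀ β
        α₀-perm : IsPermOf k α₀
        β-perm  : IsPermOf m β
        one     : #132ˡ α₀ + #132ˡ β ≡ 1
        suffix≡ : suffix σ ≡ β

      ∈-image : ∀ {i j} → #132ˡ α₀ ≡ i → #132ˡ β ≡ j → σ ∈ map (uncurry glueAB) (pairsAB i j)
      ∈-image #132-α₀ #132-β = subst (_∈ _) (sym σ≡)
        (∈-map⁺ (uncurry glueAB) (∈-cartesianProduct⁺ (∈-perms132⁺ α₀-perm #132-α₀) (∈-perms132⁺ β-perm #132-β)))

    uncrossed-split : ∀ {σ} → σ ∈ uncrossed → UncrossedSplit σ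
    uncrossed-split {σ} σ∈ with σ∈Fib , no-crossing ← ∈-filter⁻ (λ σ → crossing σ ≟ 0) {xs = Fib} σ∈
                            with σ-perm , one , σ≡ , length-prefix ← ∈-Fib⁻ σ∈Fib = record
      { α₀ = α₀ ; β = suffix σ ; σ≡ = trans σ≡ S.σ≡ ; α₀-perm = α₀-perm ; β-perm = β-perm
      ; one = trans (sym (GlueAB.#132ˡ-glueAB α₀-perm β-perm)) (trans (cong #132ˡ (sym (trans σ≡ S.σ≡))) one)
      ; suffix≡ = refl }
      where
      module S = SplitAB (subst (IsPermOf (suc top)) σ≡ σ-perm) length-prefix no-crossing
      open S using (α₀; α₀-perm; β-perm)

    pieceA-unique : Unique pieceA
    pieceA-unique = Unique.filter⁺ _ (Unique.filter⁺ _ Fib-unique)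

    pieceB-unique : Unique pieceB
    pieceB-unique = Unique.filter⁺ _ (Unique.filter⁺ _ Fib-unique)

    image→pieceA : ∀ {p} → p ∈ pairsAB 0 1 → uncurry glueAB p ∈ pieceA
    image→pieceA {α₀ , β} p∈ =
      let α₀∈ , β∈ = ∈-cartesianProduct⁻ (perms132 0 k) (perms132 1 m) p∈
          ∈uncrossed , #132-suffix = glueAB-∈ {0} {1} refl α₀∈ β∈
      in ∈-filter⁺ (λ σ → #132ˡ (suffix σ) ≟ 1) ∈uncrossed #132-suffix

    image→pieceB : ∀ {p} → p ∈ pairsAB 1 0 → uncurry glueAB p ∈ pieceB
    image→pieceB {α₀ , β} p∈ =
      let α₀∈ , β∈ = ∈-cartesianProduct⁻ (perms132 1 k) (perms132 0 m) p∈
          ∈uncrossed , #132-suffix = glueAB-∈ {1} {0} refl α₀∈ β∈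
      in ∈-filter⁺ (¬? ∘ (λ σ → #132ˡ (suffix σ) ≟ 1)) ∈uncrossed (λ #132≡1 → 0≢1+n (trans (sym #132-suffix) #132≡1))

    pieceA→image : ∀ {σ} → σ ∈ pieceA → σ ∈ map (uncurry glueAB) (pairsAB 0 1)
    pieceA→image σ∈ with σ∈uncrossed , #132-suffix ← ∈-filter⁻ (λ σ → #132ˡ (suffix σ) ≟ 1) {xs = uncrossed} σ∈ =
      case +≡1 _ _ one of λ where
        (inj₁ (#132-α₀ , #132-β)) → ∈-image #132-α₀ #132-β
        (inj₂ (_       , #132-β)) → ⊥-elim (0≢1+n (trans (sym #132-β) (trans (cong #132ˡ (sym suffix≡)) #132-suffix)))
      where open UncrossedSplit (uncrossed-split σ∈uncrossed)

    pieceB→image : ∀ {σ} → σ ∈ pieceB → σ ∈ map (uncurry glueAB) (pairsAB 1 0)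
    pieceB→image σ∈ with σ∈uncrossed , #132-suffix≢1 ← ∈-filter⁻ (¬? ∘ (λ σ → #132ˡ (suffix σ) ≟ 1)) {xs = uncrossed} σ∈ =
      case +≡1 _ _ one of λ where
        (inj₁ (_       , #132-β)) → ⊥-elim (#132-suffix≢1 (trans (cong #132ˡ suffix≡) #132-β))
        (inj₂ (#132-α₀ , #132-β)) → ∈-image #132-α₀ #132-β
      where open UncrossedSplit (uncrossed-split σ∈uncrossed)

    crossed-unique : Unique crossed
    crossed-unique = Unique.filter⁺ _ Fib-unique

  crossed-empty-left : ∀ m → Pieces.crossed 0 m ≡ []
  crossed-empty-left m = no-members⇒[] λ σ∈ → proj₂ (∈-filter⁻ _ {xs = Pieces.Fib 0 m} σ∈) refl

  crossed-empty-right : ∀ k → Pieces.crossed k 0 ≡ []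
  crossed-empty-right k = no-members⇒[] σ∉crossed
    where
    open Pieces k 0
    open Fibre k 0

    suffix-empty : ∀ {σ} → σ ∈ Fib → suffix σ ≡ []
    suffix-empty {σ} σ∈Fib with σ-perm , _ , σ≡ , length-prefix ← ∈-Fib⁻ σ∈Fib
      with suffix σ | AroundMax.length-β (prefix σ) (suffix σ) (subst (IsPermOf (suc top)) σ≡ σ-perm) {k} {0} refl length-prefix
    ... | [] | _ = refl

    σ∉crossed : ∀ {σ} → σ ∉ crossed
    σ∉crossed {σ} σ∈ with σ∈Fib , crossing≢0 ← ∈-filter⁻ _ {xs = Fib} σ∈ =
      crossing≢0 (trans (cong (#12ˡ-across (prefix σ)) (suffix-empty σ∈Fib)) (∑-0 (prefix σ)))

  module PiecesC (k′ m′ : ℕ) where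
    open FibreC k′ m′
    open Pieces (suc k′) (suc m′)

    pairsC : List (List ℕ × List ℕ)
    pairsC = cartesianProduct (perms132 0 k′) (perms132 0 (suc m′))

    image→crossed : ∀ {p} → p ∈ pairsC → uncurry glueC p ∈ crossed
    image→crossed p∈ with α₀∈ , β₀∈ ← ∈-cartesianProduct⁻ (perms132 0 k′) (perms132 0 (suc m′)) p∈
                     with α₀-perm , #132-α₀ ← ∈-perms132⁻ α₀∈ | β₀-perm , #132-β₀ ← ∈-perms132⁻ β₀∈ =
      ∈-filter⁺ _ (∈-Fib⁺ isPermOf-glueC (trans #132ˡ-glueC (cong suc (cong₂ _+_ #132-α₀ #132-β₀))) position≡)
                  (λ crossing≡0 → 0≢1+n (trans (sym crossing≡0) (trans (cong₂ #12ˡ-across prefix≡ suffix≡) crossing≡1)))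
      where open GlueC α₀-perm β₀-perm

    crossed→image : ∀ {σ} → σ ∈ crossed → σ ∈ map (uncurry glueC) pairsC
    crossed→image {σ} σ∈ with σ∈Fib , crossing≢0 ← ∈-filter⁻ _ {xs = Fib} σ∈
                         with σ-perm , one , σ≡ , length-prefix ← ∈-Fib⁻ σ∈Fib =
      subst (_∈ _) (sym (trans σ≡ S.σ≡))
        (∈-map⁺ (uncurry glueC) (∈-cartesianProduct⁺ (∈-perms132⁺ S.α₀-perm S.#132ˡ-α₀) (∈-perms132⁺ S.β₀-perm S.#132ˡ-β₀)))
      where
      module S = SplitC (subst (IsPermOf (suc top)) σ≡ σ-perm) length-prefix (trans (cong #132ˡ (sym σ≡)) one) crossing≢0

    glueC-injective : ∀ {p p′} → p ∈ pairsC → p′ ∈ pairsC → uncurry glueC p ≡ uncurry glueC p′ → p ≡ p′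
    glueC-injective {α₀ , β₀} {α₀′ , β₀′} p∈ p′∈ eq
      with α₀∈ , β₀∈ ← ∈-cartesianProduct⁻ (perms132 0 k′) (perms132 0 (suc m′)) p∈
         | α₀′∈ , β₀′∈ ← ∈-cartesianProduct⁻ (perms132 0 k′) (perms132 0 (suc m′)) p′∈ =
      cong₂ _,_ (List.map-injective (+-cancelˡ-≡ (suc (suc m′)) _ _)
                  (List.∷ʳ-injectiveˡ _ _ (trans (sym G.prefix≡) (trans (cong prefix eq) G′.prefix≡))))
                (List.map-injective (swap-injective m′) (trans (sym G.suffix≡) (trans (cong suffix eq) G′.suffix≡)))
      where
      module G  = GlueC (proj₁ (∈-perms132⁻ α₀∈))  (proj₁ (∈-perms132⁻ β₀∈))
      module G′ = GlueC (proj₁ (∈-perms132⁻ α₀′∈)) (proj₁ (∈-perms132⁻ β₀′∈))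

module RingSums {c ℓ : Level} (R : CommutativeRing c ℓ) where
  open import Data.Bool using (true; false)
  open import Data.Empty using (⊥-elim)
  open import Data.List using (List; []; _∷_; _++_; map; filter; cartesianProduct)
  import Data.List.Properties as List
  open import Data.List.Membership.Propositional using (_∈_)
  open import Data.List.Membership.Propositional.Properties using (∈-map⁻)
  open import Data.List.Membership.Propositional.Properties.WithK using (unique∧set⇒bag)
  open import Data.List.Relation.Binary.BagAndSetEquality using (∼bag⇒↭)
  open import Data.List.Relation.Binary.Permutation.Propositional using (_↭_; ↭⇒↭ₛ′)
  import Data.List.Relation.Binary.Permutation.Propositional.Properties as ↭
  import Data.List.Relation.Binary.Permutation.Setoid.Properties as ↭ₛ
  open import Data.List.Relation.Unary.All as All using (All; []; _∷_)
  open import Data.List.Relation.Unary.AllPairs using ([]; _∷_)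
  open import Data.List.Relation.Unary.Any using (here; there)
  open import Data.List.Relation.Unary.Unique.Propositional using (Unique)
  open import Data.Nat using (_≟_)
  open import Data.Product using (_,_)
  open import Function using (_∘_; mk⇔)
  open import Relation.Binary.PropositionalEquality as ≡ using (_≡_)
  open import Relation.Nullary using (Dec; yes; no; does; ¬?)

  open PermutationLists using (unique-map⁺; fibre)

  private
    variable
      A B : Set

  open CommutativeRing R
  open Series R using (sumR)
  open import Relation.Binary.Reasoning.Setoid setoid

  ∑ᴿ : List A → (A → Carrier) → Carrier
  ∑ᴿ xs f = sumR (map f xs)

  ∑ᴿ-cong : ∀ (xs : List A) {f g} → (∀ {x} → x ∈ xs → f x ≈ g x) → ∑ᴿ xs f ≈ ∑ᴿ xs g
  ∑ᴿ-cong []       f≈g = refl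
  ∑ᴿ-cong (x ∷ xs) f≈g = +-cong (f≈g (here ≡.refl)) (∑ᴿ-cong xs (f≈g ∘ there))

  ∑ᴿ-map : ∀ (g : B → A) xs (f : A → Carrier) → ∑ᴿ (map g xs) f ≡ ∑ᴿ xs (f ∘ g)
  ∑ᴿ-map g xs f = ≡.cong sumR (≡.sym (List.map-∘ xs))

  ∑ᴿ-++ : ∀ (xs ys : List A) f → ∑ᴿ (xs ++ ys) f ≈ ∑ᴿ xs f + ∑ᴿ ys f
  ∑ᴿ-++ []       ys f = sym (+-identityˡ _)
  ∑ᴿ-++ (x ∷ xs) ys f = trans (+-congˡ (∑ᴿ-++ xs ys f)) (sym (+-assoc _ _ _))

  ∑ᴿ-0 : ∀ (xs : List A) → ∑ᴿ xs (λ _ → 0#) ≈ 0#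
  ∑ᴿ-0 []       = refl
  ∑ᴿ-0 (x ∷ xs) = trans (+-congˡ (∑ᴿ-0 xs)) (+-identityˡ 0#)

  ∑ᴿ-+ : ∀ (xs : List A) f g → ∑ᴿ xs (λ x → f x + g x) ≈ ∑ᴿ xs f + ∑ᴿ xs g
  ∑ᴿ-+ []       f g = sym (+-identityˡ 0#)
  ∑ᴿ-+ (x ∷ xs) f g = begin
    f x + g x + ∑ᴿ xs (λ x → f x + g x) ≈⟨ +-congˡ (∑ᴿ-+ xs f g) ⟩
    f x + g x + (∑ᴿ xs f + ∑ᴿ xs g)     ≈⟨ +-assoc (f x) (g x) _ ⟩
    f x + (g x + (∑ᴿ xs f + ∑ᴿ xs g))   ≈⟨ +-congˡ (x+[y+z]≈y+[x+z] (g x) (∑ᴿ xs f) (∑ᴿ xs g)) ⟩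
    f x + (∑ᴿ xs f + (g x + ∑ᴿ xs g))   ≈⟨ +-assoc (f x) _ _ ⟨
    f x + ∑ᴿ xs f + (g x + ∑ᴿ xs g)     ∎
    where
    x+[y+z]≈y+[x+z] : ∀ a b d → a + (b + d) ≈ b + (a + d)
    x+[y+z]≈y+[x+z] a b d = trans (sym (+-assoc a b d)) (trans (+-congʳ (+-comm a b)) (+-assoc b a d))

  ∑ᴿ-*ˡ : ∀ a (xs : List A) f → a * ∑ᴿ xs f ≈ ∑ᴿ xs (λ x → a * f x)
  ∑ᴿ-*ˡ a []       f = zeroʳ a
  ∑ᴿ-*ˡ a (x ∷ xs) f = trans (distribˡ a _ _) (+-congˡ (∑ᴿ-*ˡ a xs f))

  ∑ᴿ-*ʳ : ∀ a (xs : List A) f → ∑ᴿ xs f * a ≈ ∑ᴿ xs (λ x → f x * a)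
  ∑ᴿ-*ʳ a []       f = zeroˡ a
  ∑ᴿ-*ʳ a (x ∷ xs) f = trans (distribʳ a _ _) (+-congˡ (∑ᴿ-*ʳ a xs f))

  ∑ᴿ-cartesianProduct : ∀ (xs : List A) (ys : List B) f g →
                        ∑ᴿ (cartesianProduct xs ys) (λ (x , y) → f x * g y) ≈ ∑ᴿ xs f * ∑ᴿ ys g
  ∑ᴿ-cartesianProduct []       ys f g = sym (zeroˡ _)
  ∑ᴿ-cartesianProduct (x ∷ xs) ys f g = begin
    ∑ᴿ (map (x ,_) ys ++ cartesianProduct xs ys) _      ≈⟨ ∑ᴿ-++ (map (x ,_) ys) _ _ ⟩
    ∑ᴿ (map (x ,_) ys) _ + ∑ᴿ (cartesianProduct xs ys) _ ≈⟨ +-cong (reflexive (∑ᴿ-map (x ,_) ys _)) (∑ᴿ-cartesianProduct xs ys f g) ⟩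
    ∑ᴿ ys (λ y → f x * g y) + ∑ᴿ xs f * ∑ᴿ ys g        ≈⟨ +-congʳ (∑ᴿ-*ˡ (f x) ys g) ⟨
    f x * ∑ᴿ ys g + ∑ᴿ xs f * ∑ᴿ ys g                  ≈⟨ distribʳ (∑ᴿ ys g) (f x) (∑ᴿ xs f) ⟨
    (f x + ∑ᴿ xs f) * ∑ᴿ ys g                          ∎

  ∑ᴿ-filter : ∀ {P : A → Set} (P? : ∀ x → Dec (P x)) xs f →
              ∑ᴿ xs f ≈ ∑ᴿ (filter P? xs) f + ∑ᴿ (filter (¬? ∘ P?) xs) f
  ∑ᴿ-filter P? []       f = sym (+-identityˡ 0#)
  ∑ᴿ-filter P? (x ∷ xs) f with does (P? x)
  ... | true  = trans (+-congˡ (∑ᴿ-filter P? xs f)) (sym (+-assoc _ _ _))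
  ... | false = trans (+-congˡ (∑ᴿ-filter P? xs f)) (trans (sym (+-assoc _ _ _))
                      (trans (+-congʳ (+-comm _ _)) (+-assoc _ _ _)))

  ∑ᴿ-↭ : ∀ {xs ys : List A} f → xs ↭ ys → ∑ᴿ xs f ≈ ∑ᴿ ys f
  ∑ᴿ-↭ f xs↭ys = ↭ₛ.foldr-commMonoid setoid +-isCommutativeMonoid (↭⇒↭ₛ′ isEquivalence (↭.map⁺ f xs↭ys))

  ∑ᴿ-image : ∀ {xs : List A} {ys : List B} (g : B → A) f → Unique xs → Unique ys →
             (∀ {y y′} → y ∈ ys → y′ ∈ ys → g y ≡ g y′ → y ≡ y′) →
             (∀ {y} → y ∈ ys → g y ∈ xs) → (∀ {x} → x ∈ xs → x ∈ map g ys) →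
             ∑ᴿ xs f ≈ ∑ᴿ ys (f ∘ g)
  ∑ᴿ-image {ys = ys} g f xs! ys! g-inj g∈ ∈g = trans
    (∑ᴿ-↭ f (∼bag⇒↭ (unique∧set⇒bag xs! (unique-map⁺ g g-inj ys!) (mk⇔ ∈g from))))
    (reflexive (∑ᴿ-map g ys f))
    where
    from : ∀ {x} → x ∈ map g ys → x ∈ _
    from x∈ with y , y∈ , ≡.refl ← ∈-map⁻ g x∈ = g∈ y∈

  ∑ᴿ-≡ : ∀ {xs ys : List A} f → xs ≡ ys → ∑ᴿ xs f ≈ ∑ᴿ ys f
  ∑ᴿ-≡ f xs≡ys = reflexive (≡.cong (λ l → ∑ᴿ l f) xs≡ys)

  module _ (key : A → ℕ) (f : A → Carrier) where

    private
      key≟ : ∀ k x → Dec (key x ≡ k)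
      key≟ k x = key x ≟ k

      ∑ᴿ-fibre-[x] : ∀ x {ks} → Unique ks → key x ∈ ks → ∑ᴿ ks (λ k → ∑ᴿ (fibre key k (x ∷ [])) f) ≈ f x
      ∑ᴿ-fibre-[x] x {k ∷ ks} (k∉ ∷ ks!) x∈ with key x ≟ k
      ... | yes key≡k = begin
        ∑ᴿ (fibre key k (x ∷ [])) f + ∑ᴿ ks (λ k′ → ∑ᴿ (fibre key k′ (x ∷ [])) f)
          ≈⟨ +-cong (∑ᴿ-≡ f (List.filter-accept (key≟ k) key≡k)) (trans (∑ᴿ-cong ks empty) (∑ᴿ-0 ks)) ⟩
        f x + 0# + 0#  ≈⟨ trans (+-identityʳ _) (+-identityʳ _) ⟩
        f x            ∎
        where
        empty : ∀ {k′} → k′ ∈ ks → ∑ᴿ (fibre key k′ (x ∷ [])) f ≈ 0#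
        empty k′∈ = ∑ᴿ-≡ f (List.filter-reject (key≟ _) (λ key≡k′ → All.lookup k∉ k′∈ (≡.trans (≡.sym key≡k) key≡k′)))
      ... | no key≢k with x∈
      ...   | here key≡k = ⊥-elim (key≢k key≡k)
      ...   | there x∈ks = begin
        ∑ᴿ (fibre key k (x ∷ [])) f + ∑ᴿ ks (λ k′ → ∑ᴿ (fibre key k′ (x ∷ [])) f)
          ≈⟨ +-cong (∑ᴿ-≡ f (List.filter-reject (key≟ k) key≢k)) (∑ᴿ-fibre-[x] x ks! x∈ks) ⟩
        0# + f x ≈⟨ +-identityˡ _ ⟩
        f x      ∎

    ∑ᴿ-fibres : ∀ {ks} → Unique ks → ∀ xs → (∀ {x} → x ∈ xs → key x ∈ ks) →
                ∑ᴿ xs f ≈ ∑ᴿ ks (λ k → ∑ᴿ (fibre key k xs) f)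
    ∑ᴿ-fibres {ks} ks! []       _     = sym (∑ᴿ-0 ks)
    ∑ᴿ-fibres {ks} ks! (x ∷ xs) keys∈ = begin
      f x + ∑ᴿ xs f
        ≈⟨ +-cong (sym (∑ᴿ-fibre-[x] x ks! (keys∈ (here ≡.refl)))) (∑ᴿ-fibres ks! xs (keys∈ ∘ there)) ⟩
      ∑ᴿ ks (λ k → ∑ᴿ (fibre key k (x ∷ [])) f) + ∑ᴿ ks (λ k → ∑ᴿ (fibre key k xs) f)
        ≈⟨ ∑ᴿ-+ ks _ _ ⟨
      ∑ᴿ ks (λ k → ∑ᴿ (fibre key k (x ∷ [])) f + ∑ᴿ (fibre key k xs) f)
        ≈⟨ ∑ᴿ-cong ks (λ {k} _ → trans (sym (∑ᴿ-++ (fibre key k (x ∷ [])) (fibre key k xs) f))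
                                        (∑ᴿ-≡ f (≡.sym (List.filter-++ (key≟ k) (x ∷ []) xs)))) ⟩
      ∑ᴿ ks (λ k → ∑ᴿ (fibre key k (x ∷ xs)) f) ∎

module GeneratingFunctions {c ℓ : Level} (R : CommutativeRing c ℓ) where
  open import Data.Fin as Fin using (toℕ; fromℕ<)
  open import Data.Fin.Properties using (toℕ<n; toℕ-injective; toℕ-fromℕ<)
  open import Data.List using (List; _∷_; map; filter; cartesianProduct; allFin)
  import Data.List.Properties as List
  open import Data.List.Membership.Propositional using (_∈_)
  open import Data.List.Membership.Propositional.Properties using (∈-map⁺; ∈-map⁻; ∈-allFin; ∈-cartesianProduct⁻)
  open import Data.List.Relation.Unary.Unique.Propositional using (Unique)
  import Data.List.Relation.Unary.Unique.Propositional.Properties as Unique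
  open import Data.Nat as ℕ using (zero; suc; _∸_)
  import Data.Nat.Properties as ℕ
  open import Data.Product using (_×_; _,_; proj₁; proj₂; uncurry)
  open import Function using (_∘_)
  open import Relation.Binary.PropositionalEquality as ≡ using (_≡_)

  open ListSums
  open PatternCounts
  open PermutationLists
  open Decomposition

  open CommutativeRing R
  open Series R using (Ser; gf; P; Q; sumR; _^_; _⊛_; _⊖_; one; zMul)
  open RingSums R
  open import Relation.Binary.Reasoning.Setoid setoid
  import Algebra.Properties.CommutativeSemiring.Exp commutativeSemiring as Exp
  import Algebra.Solver.CommutativeMonoid *-commutativeMonoid as *-Solver

  ^≡^ : ∀ x n → x ^ n ≡ x Exp.^ n
  ^≡^ x zero    = ≡.refl
  ^≡^ x (suc n) = ≡.cong (x *_) (^≡^ x n)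

  ^-homo-* : ∀ x m n → x ^ (m ℕ.+ n) ≈ x ^ m * x ^ n
  ^-homo-* x m n = trans (reflexive (^≡^ x (m ℕ.+ n)))
    (trans (Exp.^-homo-* x m n) (sym (*-cong (reflexive (^≡^ x m)) (reflexive (^≡^ x n)))))

  ^-distrib-* : ∀ x y n → (x * y) ^ n ≈ x ^ n * y ^ n
  ^-distrib-* x y n = trans (reflexive (^≡^ (x * y) n))
    (trans (Exp.^-distrib-* x y n) (sym (*-cong (reflexive (^≡^ x n)) (reflexive (^≡^ y n)))))

  1^n≈1 : ∀ n → 1# ^ n ≈ 1#
  1^n≈1 zero    = refl
  1^n≈1 (suc n) = trans (*-identityˡ _) (1^n≈1 n)

  1^n*x≈x : ∀ n x → 1# ^ n * x ≈ x
  1^n*x≈x n x = trans (*-congʳ (1^n≈1 n)) (*-identityˡ x)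

  weight : Carrier → Carrier → List ℕ → Carrier
  weight a b σ = a ^ #123ˡ σ * b ^ #12ˡ σ

  S : ℕ → ℕ → Carrier → Carrier → Carrier
  S i n a b = ∑ᴿ (perms132 i n) (weight a b)

  gf≈ : ∀ i n a c b → gf (λ n → filter (λ π → #132 π ℕ.≟ i) (perms n)) a c b n ≈ c ^ n * S i n a b
  gf≈ i n a c b = *-congˡ (begin
    sumR (map (λ π → a ^ #123 π * b ^ #12 π) L)
      ≡⟨ ≡.cong sumR (List.map-cong (λ π → ≡.cong₂ (λ u v → a ^ u * b ^ v) (#123≡#123ˡ π) (#12≡#12ˡ π)) L) ⟩
    ∑ᴿ L (weight a b ∘ word)      ≡⟨ ∑ᴿ-map word L (weight a b) ⟨
    ∑ᴿ (map word L) (weight a b)  ≈⟨ ∑ᴿ-≡ (weight a b) (perms132≡ i n) ⟨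
    S i n a b                     ∎)
    where L = filter (λ π → #132 π ℕ.≟ i) (perms n)

  module _ (q t : Carrier) where

    weight-split : ∀ {σ α β} e → #123ˡ σ ≡ #12ˡ α ℕ.+ (#123ˡ α ℕ.+ #123ˡ β) → #12ˡ σ ≡ e ℕ.+ (#12ˡ α ℕ.+ #12ˡ β) →
                   weight q t σ ≈ t ^ e * (weight q (q * t) α * weight q t β)
    weight-split {σ} {α} {β} e #123≡ #12≡ = begin
      q ^ #123ˡ σ * t ^ #12ˡ σ
        ≡⟨ ≡.cong₂ (λ u v → q ^ u * t ^ v) #123≡ #12≡ ⟩
      q ^ (#12ˡ α ℕ.+ (#123ˡ α ℕ.+ #123ˡ β)) * t ^ (e ℕ.+ (#12ˡ α ℕ.+ #12ˡ β))
        ≈⟨ *-cong (trans (^-homo-* q (#12ˡ α) _) (*-congˡ (^-homo-* q (#123ˡ α) (#123ˡ β))))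
                  (trans (^-homo-* t e _) (*-congˡ (^-homo-* t (#12ˡ α) (#12ˡ β)))) ⟩
      (q ^ #12ˡ α * (q ^ #123ˡ α * q ^ #123ˡ β)) * (t ^ e * (t ^ #12ˡ α * t ^ #12ˡ β))
        ≈⟨ rearrange (q ^ #12ˡ α) (q ^ #123ˡ α) (q ^ #123ˡ β) (t ^ e) (t ^ #12ˡ α) (t ^ #12ˡ β) ⟩
      t ^ e * ((q ^ #123ˡ α * (q ^ #12ˡ α * t ^ #12ˡ α)) * (q ^ #123ˡ β * t ^ #12ˡ β))
        ≈⟨ *-congˡ (*-congʳ (*-congˡ (^-distrib-* q t (#12ˡ α)))) ⟨
      t ^ e * (weight q (q * t) α * weight q t β) ∎
      where
      open *-Solver
      rearrange : ∀ a b d e f g → (a * (b * d)) * (e * (f * g)) ≈ e * ((b * (a * f)) * (d * g))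
      rearrange = solve 6 (λ a b d e f g → (a ⊕ (b ⊕ d)) ⊕ (e ⊕ (f ⊕ g)) ⊜ e ⊕ ((b ⊕ (a ⊕ f)) ⊕ (d ⊕ g))) refl

    W W′ : List ℕ → Carrier
    W  = weight q t
    W′ = weight q (q * t)

    ∑-piece : ∀ {xs L₁ L₂ : List (List ℕ)} (g : List ℕ × List ℕ → List ℕ) e → Unique xs → Unique L₁ → Unique L₂ →
              (∀ {p p′} → p ∈ cartesianProduct L₁ L₂ → p′ ∈ cartesianProduct L₁ L₂ → g p ≡ g p′ → p ≡ p′) →
              (∀ {p} → p ∈ cartesianProduct L₁ L₂ → g p ∈ xs) → (∀ {σ} → σ ∈ xs → σ ∈ map g (cartesianProduct L₁ L₂)) →
              (∀ {α β} → α ∈ L₁ → β ∈ L₂ → W (g (α , β)) ≈ t ^ e * (W′ α * W β)) →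
              ∑ᴿ xs W ≈ t ^ e * (∑ᴿ L₁ W′ * ∑ᴿ L₂ W)
    ∑-piece {xs} {L₁} {L₂} g e xs! L₁! L₂! g-inj g∈ ∈g W∘g≈ = begin
      ∑ᴿ xs W                                              ≈⟨ ∑ᴿ-image g W xs! (Unique.cartesianProduct⁺ L₁! L₂!) g-inj g∈ ∈g ⟩
      ∑ᴿ (cartesianProduct L₁ L₂) (W ∘ g)                  ≈⟨ ∑ᴿ-cong (cartesianProduct L₁ L₂) W∘g≈′ ⟩
      ∑ᴿ (cartesianProduct L₁ L₂) (λ (α , β) → t ^ e * (W′ α * W β)) ≈⟨ ∑ᴿ-*ˡ (t ^ e) (cartesianProduct L₁ L₂) _ ⟨
      t ^ e * ∑ᴿ (cartesianProduct L₁ L₂) (λ (α , β) → W′ α * W β) ≈⟨ *-congˡ (∑ᴿ-cartesianProduct L₁ L₂ W′ W) ⟩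
      t ^ e * (∑ᴿ L₁ W′ * ∑ᴿ L₂ W)                         ∎
      where
      W∘g≈′ : ∀ {p} → p ∈ cartesianProduct L₁ L₂ → W (g p) ≈ t ^ e * (W′ (proj₁ p) * W (proj₂ p))
      W∘g≈′ {α , β} p∈ = let α∈ , β∈ = ∈-cartesianProduct⁻ L₁ L₂ p∈ in W∘g≈ α∈ β∈

    module _ (k m : ℕ) where
      open Fibre k m
      open Pieces k m

      weight-glueAB : ∀ {i j α₀ β} → α₀ ∈ perms132 i k → β ∈ perms132 j m → W (glueAB α₀ β) ≈ t ^ k * (W′ α₀ * W β)
      weight-glueAB {α₀ = α₀} {β} α₀∈ β∈ = weight-split {glueAB α₀ β} {α₀} {β} k #123ˡ-glueAB #12ˡ-glueAB
        where open GlueAB (proj₁ (∈-perms132⁻ α₀∈)) (proj₁ (∈-perms132⁻ β∈))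

      ∑-pieceA : ∑ᴿ pieceA W ≈ t ^ k * (S 0 k q (q * t) * S 1 m q t)
      ∑-pieceA = ∑-piece (uncurry glueAB) k pieceA-unique (perms132-unique 0 k) (perms132-unique 1 m)
                         glueAB-injective image→pieceA pieceA→image weight-glueAB

      ∑-pieceB : ∑ᴿ pieceB W ≈ t ^ k * (S 1 k q (q * t) * S 0 m q t)
      ∑-pieceB = ∑-piece (uncurry glueAB) k pieceB-unique (perms132-unique 1 k) (perms132-unique 0 m)
                         glueAB-injective image→pieceB pieceB→image weight-glueAB

    crossedSum : ℕ → ℕ → Carrier
    crossedSum zero     m        = 0#
    crossedSum (suc k′) zero     = 0#
    crossedSum (suc k′) (suc m′) = t ^ suc (suc k′) * (S 0 k′ q (q * t) * S 0 (suc m′) q t)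

    ∑-crossed : ∀ k m → ∑ᴿ (Pieces.crossed k m) W ≈ crossedSum k m
    ∑-crossed zero     m        = ∑ᴿ-≡ W (crossed-empty-left m)
    ∑-crossed (suc k′) zero     = ∑ᴿ-≡ W (crossed-empty-right (suc k′))
    ∑-crossed (suc k′) (suc m′) =
      ∑-piece (uncurry glueC) (suc (suc k′)) crossed-unique (perms132-unique 0 k′) (perms132-unique 0 (suc m′))
              glueC-injective image→crossed crossed→image weight-glueC
      where
      open FibreC k′ m′
      open Pieces (suc k′) (suc m′)
      open PiecesC k′ m′
      weight-glueC : ∀ {α₀ β₀} → α₀ ∈ perms132 0 k′ → β₀ ∈ perms132 0 (suc m′) →
                     W (glueC α₀ β₀) ≈ t ^ suc (suc k′) * (W′ α₀ * W β₀)
      weight-glueC {α₀} {β₀} α₀∈ β₀∈ = weight-split {glueC α₀ β₀} {α₀} {β₀} (suc (suc k′)) #123ˡ-glueC #12ˡ-glueC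
        where open GlueC (proj₁ (∈-perms132⁻ α₀∈)) (proj₁ (∈-perms132⁻ β₀∈))

    fibreSum : ℕ → ℕ → Carrier
    fibreSum k N = ∑ᴿ (fibre (position N) k (perms132 1 (suc N))) W

    fibreSum-decomposition : ∀ k m → fibreSum k (k ℕ.+ m) ≈
      t ^ k * (S 0 k q (q * t) * S 1 m q t) + t ^ k * (S 1 k q (q * t) * S 0 m q t) + crossedSum k m
    fibreSum-decomposition k m = begin
      ∑ᴿ Fib W                                    ≈⟨ ∑ᴿ-filter (λ σ → crossing σ ℕ.≟ 0) Fib W ⟩
      ∑ᴿ uncrossed W + ∑ᴿ crossed W               ≈⟨ +-congʳ (∑ᴿ-filter (λ σ → #132ˡ (suffix σ) ℕ.≟ 1) uncrossed W) ⟩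
      ∑ᴿ pieceA W + ∑ᴿ pieceB W + ∑ᴿ crossed W    ≈⟨ +-cong (+-cong (∑-pieceA k m) (∑-pieceB k m)) (∑-crossed k m) ⟩
      _                                           ∎
      where
      open Fibre k m
      open Pieces k m

  positions : ℕ → List ℕ
  positions N = map toℕ (allFin (suc N))

  positions-unique : ∀ N → Unique (positions N)
  positions-unique N = Unique.map⁺ toℕ-injective (Unique.allFin⁺ (suc N))

  ∈-positions : ∀ {k N} → k ℕ.< suc N → k ∈ positions N
  ∈-positions k<1+N = ≡.subst (_∈ _) (toℕ-fromℕ< k<1+N) (∈-map⁺ toℕ (∈-allFin (fromℕ< k<1+N)))

  positions-suc : ∀ N → positions (suc N) ≡ 0 ∷ map suc (positions N)
  positions-suc N = ≡.cong (0 ∷_) (≡.trans (List.map-tabulate Fin.suc toℕ)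
    (≡.sym (≡.trans (≡.sym (List.map-∘ (allFin (suc N)))) (List.map-tabulate (λ i → i) (suc ∘ toℕ)))))

  ⊛-as-∑ᴿ : ∀ f g N → (f ⊛ g) N ≡ ∑ᴿ (positions N) (λ k → f k * g (N ∸ k))
  ⊛-as-∑ᴿ f g N = ≡.sym (∑ᴿ-map toℕ (allFin (suc N)) _)

  module Coefficients (q t : Carrier) where
    P′ Q′ P₁ Q₁ : Ser
    P′ = P q t (q * t)
    Q′ = Q q t (q * t)
    P₁ = P q 1# t
    Q₁ = Q q 1# t

    S1-fibres : ∀ N → S 1 (suc N) q t ≈ ∑ᴿ (positions N) (λ k → fibreSum q t k N)
    S1-fibres N = ∑ᴿ-fibres (position N) (W q t) (positions-unique N) (perms132 1 (suc N)) position∈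
      where
      position∈ : ∀ {σ} → σ ∈ perms132 1 (suc N) → position N σ ∈ positions N
      position∈ {σ} σ∈ with σ-perm , _ ← ∈-perms132⁻ σ∈ =
        ∈-positions (≡.subst (position N σ ℕ.<_) (IsPermOf.length≡ σ-perm)
                              (position<length σ (IsPermOf.complete σ-perm (ℕ.n<1+n N))))

    fibreSum-at : ∀ N {k} → k ∈ positions N → fibreSum q t k N ≈
      t ^ k * (S 0 k q (q * t) * S 1 (N ∸ k) q t) + t ^ k * (S 1 k q (q * t) * S 0 (N ∸ k) q t) + crossedSum q t k (N ∸ k)
    fibreSum-at N {k} k∈ with i , _ , ≡.refl ← ∈-map⁻ toℕ k∈ =
      trans (reflexive (≡.cong (fibreSum q t k) (≡.sym (ℕ.m+[n∸m]≡n (ℕ.≤-pred (toℕ<n i))))))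
            (fibreSum-decomposition q t k (N ∸ k))

    ⊛-product : ∀ {f g : Ser} N (a b : ℕ → Carrier) → (∀ k → f k ≈ t ^ k * a k) → (∀ m → g m ≈ b m) →
                (f ⊛ g) N ≈ ∑ᴿ (positions N) (λ k → t ^ k * (a k * b (N ∸ k)))
    ⊛-product {f} {g} N a b f≈ g≈ = trans (reflexive (⊛-as-∑ᴿ f g N))
      (∑ᴿ-cong (positions N) (λ {k} _ → trans (*-cong (f≈ k) (g≈ (N ∸ k))) (*-assoc _ _ _)))

    P′⊛Q₁ : ∀ N → (P′ ⊛ Q₁) N ≈ ∑ᴿ (positions N) (λ k → t ^ k * (S 0 k q (q * t) * S 1 (N ∸ k) q t))
    P′⊛Q₁ N = ⊛-product {P′} {Q₁} N (λ k → S 0 k q (q * t)) (λ m → S 1 m q t)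
                        (λ k → gf≈ 0 k q t (q * t)) (λ m → trans (gf≈ 1 m q 1# t) (1^n*x≈x m _))

    Q′⊛P₁ : ∀ N → (Q′ ⊛ P₁) N ≈ ∑ᴿ (positions N) (λ k → t ^ k * (S 1 k q (q * t) * S 0 (N ∸ k) q t))
    Q′⊛P₁ N = ⊛-product {Q′} {P₁} N (λ k → S 1 k q (q * t)) (λ m → S 0 m q t)
                        (λ k → gf≈ 1 k q t (q * t)) (λ m → trans (gf≈ 0 m q 1# t) (1^n*x≈x m _))

    [P₁⊖one]-suc : ∀ j → (P₁ ⊖ one) (suc j) ≈ S 0 (suc j) q t
    [P₁⊖one]-suc j = trans (+-cong (trans (gf≈ 0 (suc j) q 1# t) (1^n*x≈x (suc j) _)) -0#≈0#) (+-identityʳ _)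
      where
      -0#≈0# : - 0# ≈ 0#
      -0#≈0# = trans (sym (+-identityˡ (- 0#))) (-‿inverseʳ 0#)

    [P₁⊖one]-zero : (P₁ ⊖ one) 0 ≈ 0#
    [P₁⊖one]-zero = trans (+-congʳ (trans (*-identityˡ _) (trans (+-identityʳ _) (*-identityˡ 1#)))) (-‿inverseʳ 1#)

    crossed-term : ∀ k′ j → (t * t) * (P′ k′ * (P₁ ⊖ one) j) ≈ crossedSum q t (suc k′) j
    crossed-term k′ zero    = trans (*-congˡ (trans (*-congˡ [P₁⊖one]-zero) (zeroʳ _))) (zeroʳ _)
    crossed-term k′ (suc j) = trans (*-congˡ (*-cong (gf≈ 0 k′ q t (q * t)) ([P₁⊖one]-suc j)))
                                    (rearrange t (t ^ k′) (S 0 k′ q (q * t)) (S 0 (suc j) q t))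
      where
      open *-Solver
      rearrange : ∀ a b d e → (a * a) * ((b * d) * e) ≈ (a * (a * b)) * (d * e)
      rearrange = solve 4 (λ a b d e → (a ⊕ a) ⊕ ((b ⊕ d) ⊕ e) ⊜ (a ⊕ (a ⊕ b)) ⊕ (d ⊕ e)) refl

    ⊛-crossed : ∀ N → (t * t) * zMul (P′ ⊛ (P₁ ⊖ one)) N ≈ ∑ᴿ (positions N) (λ k → crossedSum q t k (N ∸ k))
    ⊛-crossed zero    = trans (zeroʳ _) (sym (+-identityˡ 0#))
    ⊛-crossed (suc N) = begin
      (t * t) * (P′ ⊛ (P₁ ⊖ one)) N
        ≈⟨ *-congˡ (reflexive (⊛-as-∑ᴿ P′ (P₁ ⊖ one) N)) ⟩
      (t * t) * ∑ᴿ (positions N) (λ k → P′ k * (P₁ ⊖ one) (N ∸ k))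
        ≈⟨ trans (∑ᴿ-*ˡ (t * t) (positions N) _) (∑ᴿ-cong (positions N) (λ {k} _ → crossed-term k (N ∸ k))) ⟩
      ∑ᴿ (positions N) (λ k → crossedSum q t (suc k) (N ∸ k))
        ≈⟨ +-identityˡ _ ⟨
      0# + ∑ᴿ (positions N) (λ k → crossedSum q t (suc k) (N ∸ k))
        ≡⟨ ≡.cong (0# +_) (∑ᴿ-map suc (positions N) (λ k → crossedSum q t k (suc N ∸ k))) ⟨
      ∑ᴿ (0 ∷ map suc (positions N)) (λ k → crossedSum q t k (suc N ∸ k))
        ≡⟨ ≡.cong (λ ks → ∑ᴿ ks (λ k → crossedSum q t k (suc N ∸ k))) (positions-suc N) ⟨
      ∑ᴿ (positions (suc N)) (λ k → crossedSum q t k (suc N ∸ k)) ∎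

mainTheorem2 : {c ℓ : Level} (R : CommutativeRing c ℓ) → let open Series R in
    (q t : CommutativeRing.Carrier R) → (n : ℕ) →
      CommutativeRing._≈_ R (Q q (CommutativeRing.1# R) t n)
        ((  zMul (P q t (CommutativeRing._*_ R q t) ⊛ Q q (CommutativeRing.1# R) t)
          ⊕ zMul (Q q t (CommutativeRing._*_ R q t) ⊛ P q (CommutativeRing.1# R) t)
          ⊕ CommutativeRing._*_ R t t · zMul (zMul (P q t (CommutativeRing._*_ R q t) ⊛ (P q (CommutativeRing.1# R) t ⊖ one)))) n)
mainTheorem2 R q t zero    = -- one132 0 evaluates to []
  trans (zeroʳ 1#) (sym (trans (+-cong (+-identityˡ 0#) (zeroʳ (t * t))) (+-identityˡ 0#)))
  where open CommutativeRing R
mainTheorem2 R q t (suc N) = begin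
  Q₁ (suc N)                                      ≈⟨ trans (gf≈ 1 (suc N) q 1# t) (1^n*x≈x (suc N) _) ⟩
  S 1 (suc N) q t                                 ≈⟨ S1-fibres N ⟩
  ∑ᴿ (positions N) (λ k → fibreSum q t k N)       ≈⟨ ∑ᴿ-cong (positions N) (fibreSum-at N) ⟩
  ∑ᴿ (positions N) (λ k → A k + B k + C k)
    ≈⟨ trans (∑ᴿ-+ (positions N) (λ k → A k + B k) C) (+-congʳ (∑ᴿ-+ (positions N) A B)) ⟩
  ∑ᴿ (positions N) A + ∑ᴿ (positions N) B + ∑ᴿ (positions N) C ≈⟨ +-cong (+-cong (P′⊛Q₁ N) (Q′⊛P₁ N)) (⊛-crossed N) ⟨
  (P′ ⊛ Q₁) N + (Q′ ⊛ P₁) N + (t * t) * zMul (P′ ⊛ (P₁ ⊖ one)) N ∎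
  where
  open CommutativeRing R
  open Series R
  open RingSums R
  open GeneratingFunctions R
  open Coefficients q t
  open import Relation.Binary.Reasoning.Setoid setoid
  A B C : ℕ → Carrier
  A k = t ^ k * (S 0 k q (q * t) * S 1 (N ∸ k) q t)
  B k = t ^ k * (S 1 k q (q * t) * S 0 (N ∸ k) q t)
  C k = crossedSum q t k (N ∸ k)
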